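{- Let $\mathscr C\le\mathbb F_q^n$ be a minimal linear code with minimum Hamming distance $d$, and let $i$ be an integer with $d\le i\le n/2$ (so $n\ge 2i$). Suppose there is no coordinate $j\in[n]$ such that $x_j\neq0$ for every codeword $x\in\mathscr C$ of weight $i$. Then \[ W_i(\mathscr C)\le (q-1)\left(\binom{n-1}{i-1}-\binom{n-i-1}{i-1}+1\right). \]
   Context: For $x\in\mathbb F_q^n$, $\sigma(x)=\{i: x_i\neq0\}$ and $w(x)=|\sigma(x)|$. A codeword $v\in\mathscr C$ is minimal if every $w\in\mathscr C$ with $\sigma(w)\subseteq\sigma(v)$ satisfies $w=\lambda v$ for some $\lambda\in\mathbb F_q$; $\mathscr C$ is minimal if all its codewords are minimal. For $0\le i\le n$, $W_i(\mathscr C)=|\{x\in\mathscr C: w(x)=i\}|$. -}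

module Defs where

open import Data.Nat using (ℕ; zero; suc; _≤_) renaming (_≟_ to _≟ℕ_)
open import Data.Fin using (Fin)
open import Data.List using (List; []; _∷_; length; filter; map; cartesianProductWith)
open import Data.List.Membership.Propositional using (_∈_)
open import Data.List.Relation.Unary.Unique.Propositional using (Unique)
open import Data.Vec using (Vec; []; _∷_; lookup; zipWith; toList)
import Data.Vec as V
open import Data.Product using (Σ; ∃; _×_; _,_)
open import Relation.Binary.PropositionalEquality using (_≡_)
open import Relation.Binary using (DecidableEquality)
open import Relation.Nullary using (¬_; Dec; ¬?)
open import Relation.Nullary.Decidable using (_×-dec_)
open import Algebra.Structures using (IsCommutativeRing)

record FiniteField : Set₁ where
  field
    Carrier  : Set
    _+_ _*_  : Carrier → Carrier → Carrier
    -_       : Carrier → Carrier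
    0# 1#    : Carrier
    isCommutativeRing : IsCommutativeRing _≡_ _+_ _*_ -_ 0# 1#
    0≢1      : ¬ (0# ≡ 1#)
    inverse  : ∀ x → ¬ (x ≡ 0#) → ∃ λ y → x * y ≡ 1#
    _≟_      : DecidableEquality Carrier
    elements : List Carrier
    complete : ∀ x → x ∈ elements
    unique   : Unique elements

  order : ℕ
  order = length elements

module Code (F : FiniteField) where
  open FiniteField F

  Word : ℕ → Set
  Word n = Vec Carrier n

  zero-word : ∀ {n} → Word n
  zero-word = V.replicate _ 0#

  _⊕_ : ∀ {n} → Word n → Word n → Word n
  x ⊕ y = zipWith _+_ x y

  _·_ : ∀ {n} → Carrier → Word n → Word n
  λ′ · x = V.map (λ′ *_) x

  InSupport : ∀ {n} → Word n → Fin n → Set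
  InSupport x j = ¬ (lookup x j ≡ 0#)

  weight : ∀ {n} → Word n → ℕ
  weight x = length (filter (λ a → ¬? (a ≟ 0#)) (toList x))

  dist : ∀ {n} → Word n → Word n → ℕ
  dist x y = length (filter (λ p → ¬? (Data.Product.proj₁ p ≟ Data.Product.proj₂ p))
                            (toList (zipWith _,_ x y)))

  allWords : ∀ n → List (Word n)
  allWords zero    = [] ∷ []
  allWords (suc n) = cartesianProductWith _∷_ elements (allWords n)

  record LinearCode (n : ℕ) : Set₁ where
    field
      _∈C   : Word n → Set
      ∈C?   : ∀ x → Dec (x ∈C)
      zero∈ : zero-word ∈C
      ⊕∈    : ∀ {x y} → x ∈C → y ∈C → (x ⊕ y) ∈C
      ·∈    : ∀ {x} (a : Carrier) → x ∈C → (a · x) ∈C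

  module _ {n : ℕ} (C : LinearCode n) where
    open LinearCode C

    MinimalCodeword : Word n → Set
    MinimalCodeword v = ∀ w → w ∈C → (∀ j → InSupport w j → InSupport v j) →
                        ∃ λ a → w ≡ a · v

    IsMinimal : Set
    IsMinimal = ∀ v → v ∈C → MinimalCodeword v

    MinDistance : ℕ → Set
    MinDistance d = (∃ λ x → ∃ λ y → x ∈C × y ∈C × ¬ (x ≡ y) × dist x y ≡ d)
                  × (∀ x y → x ∈C → y ∈C → ¬ (x ≡ y) → d ≤ dist x y)

    W : ℕ → ℕ
    W i = length (filter (λ x → ∈C? x ×-dec (weight x ≟ℕ i)) (allWords n))

{-# OPTIONS --safe #-}
-- Two weight-i codewords x, y of a minimal code have intersecting supports: if σ(x) ∩ σ(y) = ∅
-- then σ(x) ⊆ σ(x + y), and minimality of x + y forces x = 0. Codewords with the same support are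
-- nonzero multiples of one another, so W_i ≤ (q − 1)·|𝒮| for the family 𝒮 of these supports, which
-- is i-uniform, intersecting and, by hypothesis, not a star. The Hilton–Milner theorem bounds |𝒮|.
-- It is proved by Frankl's shifting: replacing the point 0 by other points keeps a family uniform,
-- intersecting and of the same size. Either some shift would create a star, and then two points
-- meet every member, reducing the bound to the Hilton–Milner bound for cross-intersecting pairs
-- (proved by the same method); or the family becomes fully shifted, and induction applies to the
-- members without 0 and to the links of 0.
module Submission where

open import Defs
open import Data.Nat using (ℕ; _≤_; _+_; _*_; _∸_)
open import Data.Nat.Combinatorics using (_C_)
open import Data.Fin using (Fin)
open import Data.Product using (∃; _×_)
open import Relation.Binary.PropositionalEquality using (_≡_)
open import Relation.Nullary using (¬_)

open import Algebra.Bundles using (CommutativeMonoid)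
open import Algebra.Structures using (IsCommutativeRing)
open import Data.Bool.Base using (Bool; true; false; not; _∧_; _∨_; if_then_else_)
open import Data.Bool.Properties
  using (∧-comm; ∧-zeroʳ; ∧-identityʳ; ∧-conicalʳ; ∨-zeroʳ; ∨-commutativeMonoid; T-≡)
  renaming (_≟_ to _≟𝔹_)
open import Data.Empty using (⊥; ⊥-elim)
open import Data.Fin.Base using (zero; suc)
import Data.Fin.Properties as Fin
open import Data.Fin.Subset using (Subset; ∁; ∣_∣) renaming (⊥ to ∅)
open import Data.Fin.Subset.Properties using (anySubset?; ∣p∣≤n; ∣p∣≤∣x∷p∣; ∣⊥∣≡0; ∣∁p∣≡n∸∣p∣)
open import Data.List.Base using (List; []; _∷_; _++_; length; filter; map; null; allFin)
open import Data.List.Membership.Propositional using (_∈_)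
open import Data.List.Membership.Propositional.Properties
  using (∈-allFin; ∈-∃++; ∈-++⁻; ∈-++⁺ˡ; ∈-++⁺ʳ; ∈-filter⁺; ∈-filter⁻; ∈-map⁺; ∈-cartesianProductWith⁺)
open import Data.List.Properties using (length-++; length-map; filter-notAll)
open import Data.List.Relation.Unary.All using ([]) renaming (lookup to All-lookup)
open import Data.List.Relation.Unary.AllPairs using ([]; _∷_)
import Data.List.Relation.Unary.Any as Any
open import Data.List.Relation.Unary.Any using (here; there)
open import Data.List.Relation.Unary.Unique.Propositional using (Unique)
import Data.List.Relation.Unary.Unique.Propositional.Properties as Unique
open import Data.Nat.Base using (suc; zero; _<_; _≡ᵇ_; z≤n; s≤s; s≤s⁻¹)
open import Data.Nat.Properties renaming (_≟_ to _≟ℕ_)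
open import Algebra.Properties.CommutativeSemigroup +-commutativeSemigroup using (interchange; x∙yz≈y∙xz)
open import Algebra.Properties.CommutativeSemigroup (CommutativeMonoid.commutativeSemigroup ∨-commutativeMonoid)
  using () renaming (x∙yz≈y∙xz to x∨[y∨z]≡y∨[x∨z])
open import Data.Nat.Combinatorics using (nCn≡1; nCk+nC[k+1]≡[n+1]C[k+1])
open import Data.Nat.Solver using (module +-*-Solver)
open +-*-Solver using (solve; _:+_; _:=_; con)
open import Data.Product.Base using (_,_)
open import Data.Sum.Base using (_⊎_; inj₁; inj₂)
open import Data.Vec.Base using ([]; _∷_; lookup; insertAt; removeAt; _[_]≔_)
import Data.Vec.Base as Vec
open import Data.Vec.Properties
  using ([]≔-lookup; []≔-idempotent; lookup∘update; lookup∘update′; insertAt-lookup; insertAt-removeAt;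
         lookup-map; lookup-zipWith; ∷-injective; ≡-dec)
open import Function.Base using (_∘_; case_of_)
open import Function.Bundles using (Equivalence)
open import Relation.Binary.PropositionalEquality
  using (refl; sym; trans; cong; cong₂; subst; subst₂; module ≡-Reasoning)
open import Relation.Nullary using (Dec; yes; no; does; ¬?)
open import Relation.Nullary.Decidable using (_×-dec_)
open import Relation.Unary using (Decidable)

-- Counting families of subsets

-- Subsets of an n-set are Boolean vectors and a family is its characteristic predicate.
-- In Subset (suc n) the head is the point 0 and y : Fin n stands for the point y+1.
Family : ℕ → Set
Family n = Subset n → Bool

𝟙 : Bool → ℕ
𝟙 true  = 1
𝟙 false = 0

∑ : ∀ {n} → (Subset n → ℕ) → ℕ
∑ {zero}  f = f []
∑ {suc n} f = ∑ (λ X → f (false ∷ X)) + ∑ (λ X → f (true ∷ X))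

card : ∀ {n} → Family n → ℕ
card F = ∑ (𝟙 ∘ F)

avoid₀ link₀ : ∀ {n} → Family (suc n) → Family n
avoid₀ F T = F (false ∷ T)
link₀  F T = F (true ∷ T)

∑-cong : ∀ {n} {f g : Subset n → ℕ} → (∀ X → f X ≡ g X) → ∑ f ≡ ∑ g
∑-cong {zero}  f≡g = f≡g []
∑-cong {suc n} f≡g = cong₂ _+_ (∑-cong (f≡g ∘ (false ∷_))) (∑-cong (f≡g ∘ (true ∷_)))

∑-mono : ∀ {n} {f g : Subset n → ℕ} → (∀ X → f X ≤ g X) → ∑ f ≤ ∑ g
∑-mono {zero}  f≤g = f≤g []
∑-mono {suc n} f≤g = +-mono-≤ (∑-mono (f≤g ∘ (false ∷_))) (∑-mono (f≤g ∘ (true ∷_)))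

∑-0 : ∀ n → ∑ {n} (λ _ → 0) ≡ 0
∑-0 zero    = refl
∑-0 (suc n) = cong₂ _+_ (∑-0 n) (∑-0 n)

∑-distrib-+ : ∀ {n} (f g : Subset n → ℕ) → ∑ (λ X → f X + g X) ≡ ∑ f + ∑ g
∑-distrib-+ {zero}  f g = refl
∑-distrib-+ {suc n} f g =
  trans (cong₂ _+_ (∑-distrib-+ (f ∘ (false ∷_)) (g ∘ (false ∷_)))
                   (∑-distrib-+ (f ∘ (true ∷_)) (g ∘ (true ∷_))))
        (interchange (∑ (f ∘ (false ∷_))) (∑ (g ∘ (false ∷_))) (∑ (f ∘ (true ∷_))) (∑ (g ∘ (true ∷_))))

∑-*ˡ : ∀ {n} c (f : Subset n → ℕ) → ∑ (λ X → c * f X) ≡ c * ∑ f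
∑-*ˡ {zero}  c f = refl
∑-*ˡ {suc n} c f = trans (cong₂ _+_ (∑-*ˡ c (f ∘ (false ∷_))) (∑-*ˡ c (f ∘ (true ∷_))))
                         (sym (*-distribˡ-+ c _ _))

∑-∁ : ∀ {n} (f : Subset n → ℕ) → ∑ (f ∘ ∁) ≡ ∑ f
∑-∁ {zero}  f = refl
∑-∁ {suc n} f = trans (cong₂ _+_ (∑-∁ (f ∘ (true ∷_))) (∑-∁ (f ∘ (false ∷_))))
                      (+-comm (∑ (f ∘ (true ∷_))) (∑ (f ∘ (false ∷_))))

∑-insertAt : ∀ {n} (r : Fin (suc n)) (f : Subset (suc n) → ℕ) →
             ∑ f ≡ ∑ (λ U → f (insertAt U r false)) + ∑ (λ U → f (insertAt U r true))
∑-insertAt         zero    f = refl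
∑-insertAt {suc n} (suc r) f =
  trans (cong₂ _+_ (∑-insertAt r (f ∘ (false ∷_))) (∑-insertAt r (f ∘ (true ∷_))))
        (interchange (∑ (λ U → f (false ∷ insertAt U r false))) (∑ (λ U → f (false ∷ insertAt U r true)))
                     (∑ (λ U → f (true ∷ insertAt U r false))) (∑ (λ U → f (true ∷ insertAt U r true))))

[]≔-self : ∀ {n} (T : Subset n) y {b} → lookup T y ≡ b → T [ y ]≔ b ≡ T
[]≔-self T y refl = []≔-lookup T y

swap₀ : ∀ {n} → Fin n → Subset (suc n) → Subset (suc n)
swap₀ y (b ∷ T) = lookup T y ∷ (T [ y ]≔ b)

swap₀-fixed : ∀ {n} (y : Fin n) b T → lookup T y ≡ b → swap₀ y (b ∷ T) ≡ b ∷ T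
swap₀-fixed y b T Ty = cong₂ _∷_ Ty ([]≔-self T y Ty)

∑-swap₀ : ∀ {n} (y : Fin n) (f : Subset (suc n) → ℕ) → ∑ (f ∘ swap₀ y) ≡ ∑ f
∑-swap₀ zero f = interchange (∑ (f ∘ (false ∷_) ∘ (false ∷_))) (∑ (f ∘ (true ∷_) ∘ (false ∷_)))
                              (∑ (f ∘ (false ∷_) ∘ (true ∷_))) (∑ (f ∘ (true ∷_) ∘ (true ∷_)))
∑-swap₀ {suc n} (suc y) f =
  trans (interchange (∑ (fix₁ false ∘ swap₀ y ∘ (false ∷_))) (∑ (fix₁ true ∘ swap₀ y ∘ (false ∷_)))
                     (∑ (fix₁ false ∘ swap₀ y ∘ (true ∷_))) (∑ (fix₁ true ∘ swap₀ y ∘ (true ∷_))))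
        (trans (cong₂ _+_ (∑-swap₀ y (fix₁ false)) (∑-swap₀ y (fix₁ true)))
               (interchange (∑ (fix₁ false ∘ (false ∷_))) (∑ (fix₁ false ∘ (true ∷_)))
                            (∑ (fix₁ true ∘ (false ∷_))) (∑ (fix₁ true ∘ (true ∷_)))))
  where
  fix₁ : Bool → Subset (suc n) → ℕ
  fix₁ c (b ∷ R) = f (b ∷ c ∷ R)

card-cong : ∀ {n} {F G : Family n} → (∀ X → F X ≡ G X) → card F ≡ card G
card-cong F≡G = ∑-cong (cong 𝟙 ∘ F≡G)

card-mono : ∀ {n} {F G : Family n} → (∀ X → F X ≡ true → G X ≡ true) → card F ≤ card G
card-mono {F = F} {G} F⊆G = ∑-mono 𝟙-mono
  where
  𝟙-mono : ∀ X → 𝟙 (F X) ≤ 𝟙 (G X)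
  𝟙-mono X with F X | F⊆G X
  ... | false | _   = z≤n
  ... | true  | F⊆G rewrite F⊆G refl = ≤-refl

card-empty : ∀ {n} (F : Family n) → (∀ X → F X ≡ false) → card F ≡ 0
card-empty {n} F F≡∅ = trans (∑-cong (cong 𝟙 ∘ F≡∅)) (∑-0 n)

card-split : ∀ {n} (F G : Family n) →
             card F ≡ card (λ X → F X ∧ G X) + card (λ X → F X ∧ not (G X))
card-split F G = trans (∑-cong (λ X → 𝟙-split (F X) (G X)))
                       (∑-distrib-+ (λ X → 𝟙 (F X ∧ G X)) (λ X → 𝟙 (F X ∧ not (G X))))
  where
  𝟙-split : ∀ a b → 𝟙 a ≡ 𝟙 (a ∧ b) + 𝟙 (a ∧ not b)
  𝟙-split false b     = refl
  𝟙-split true  false = refl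
  𝟙-split true  true  = refl

card-∪ : ∀ {n} (F G : Family n) →
         card (λ X → F X ∨ G X) + card (λ X → F X ∧ G X) ≡ card F + card G
card-∪ F G = trans (sym (∑-distrib-+ (λ X → 𝟙 (F X ∨ G X)) (λ X → 𝟙 (F X ∧ G X))))
                   (trans (∑-cong (λ X → 𝟙-∪ (F X) (G X))) (∑-distrib-+ (𝟙 ∘ F) (𝟙 ∘ G)))
  where
  𝟙-∪ : ∀ a b → 𝟙 (a ∨ b) + 𝟙 (a ∧ b) ≡ 𝟙 a + 𝟙 b
  𝟙-∪ false b     = +-identityʳ (𝟙 b)
  𝟙-∪ true  false = refl
  𝟙-∪ true  true  = refl

card-pos : ∀ {n} (F : Family n) X → F X ≡ true → 1 ≤ card F
card-pos F []          FX rewrite FX = ≤-refl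
card-pos F (false ∷ X) FX = ≤-trans (card-pos (F ∘ (false ∷_)) X FX) (m≤m+n _ _)
card-pos F (true  ∷ X) FX = ≤-trans (card-pos (F ∘ (true ∷_)) X FX) (m≤n+m _ _)

card-witness : ∀ {n} (F : Family n) → 1 ≤ card F → ∃ λ X → F X ≡ true
card-witness {zero} F 1≤∣F∣ with F [] in F[]
... | true  = [] , F[]
... | false = ⊥-elim (1+n≰n 1≤∣F∣)
card-witness {suc n} F 1≤∣F∣ with card (F ∘ (false ∷_)) in ∣F₀∣
... | suc _ = let X , FX = card-witness (F ∘ (false ∷_)) (subst (1 ≤_) (sym ∣F₀∣) (s≤s z≤n))
              in false ∷ X , FX
... | zero  = let X , FX = card-witness (F ∘ (true ∷_)) 1≤∣F∣ in true ∷ X , FX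

card≡0⇒∉ : ∀ {n} (F : Family n) → card F ≡ 0 → ∀ X → F X ≡ false
card≡0⇒∉ F ∣F∣≡0 X with F X in FX
... | false = refl
... | true  = ⊥-elim (1+n≰n (subst (1 ≤_) ∣F∣≡0 (card-pos F X FX)))

∣∷∣ : ∀ {n} b (T : Subset n) → ∣ b ∷ T ∣ ≡ 𝟙 b + ∣ T ∣
∣∷∣ false T = refl
∣∷∣ true  T = refl

∣[]≔∣ : ∀ {n} (T : Subset n) y b → 𝟙 (lookup T y) + ∣ T [ y ]≔ b ∣ ≡ 𝟙 b + ∣ T ∣
∣[]≔∣ (c ∷ T) zero b = begin
  𝟙 c + ∣ b ∷ T ∣     ≡⟨ cong (𝟙 c +_) (∣∷∣ b T) ⟩
  𝟙 c + (𝟙 b + ∣ T ∣) ≡⟨ x∙yz≈y∙xz (𝟙 c) (𝟙 b) ∣ T ∣ ⟩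
  𝟙 b + (𝟙 c + ∣ T ∣) ≡⟨ cong (𝟙 b +_) (∣∷∣ c T) ⟨
  𝟙 b + ∣ c ∷ T ∣     ∎
  where open ≡-Reasoning
∣[]≔∣ (c ∷ T) (suc y) b = begin
  𝟙 (lookup T y) + ∣ c ∷ T [ y ]≔ b ∣       ≡⟨ cong (𝟙 (lookup T y) +_) (∣∷∣ c (T [ y ]≔ b)) ⟩
  𝟙 (lookup T y) + (𝟙 c + ∣ T [ y ]≔ b ∣)   ≡⟨ x∙yz≈y∙xz (𝟙 (lookup T y)) (𝟙 c) _ ⟩
  𝟙 c + (𝟙 (lookup T y) + ∣ T [ y ]≔ b ∣)   ≡⟨ cong (𝟙 c +_) (∣[]≔∣ T y b) ⟩
  𝟙 c + (𝟙 b + ∣ T ∣)                       ≡⟨ x∙yz≈y∙xz (𝟙 c) (𝟙 b) ∣ T ∣ ⟩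
  𝟙 b + (𝟙 c + ∣ T ∣)                       ≡⟨ cong (𝟙 b +_) (∣∷∣ c T) ⟨
  𝟙 b + ∣ c ∷ T ∣                           ∎
  where open ≡-Reasoning

∣swap₀∣ : ∀ {n} (y : Fin n) X → ∣ swap₀ y X ∣ ≡ ∣ X ∣
∣swap₀∣ y (b ∷ T) = trans (∣∷∣ (lookup T y) (T [ y ]≔ b)) (trans (∣[]≔∣ T y b) (sym (∣∷∣ b T)))

∣insertAt∣ : ∀ {n} (U : Subset n) r b → ∣ insertAt U r b ∣ ≡ 𝟙 b + ∣ U ∣
∣insertAt∣ U       zero    b = ∣∷∣ b U
∣insertAt∣ (c ∷ U) (suc r) b = begin
  ∣ c ∷ insertAt U r b ∣     ≡⟨ ∣∷∣ c (insertAt U r b) ⟩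
  𝟙 c + ∣ insertAt U r b ∣   ≡⟨ cong (𝟙 c +_) (∣insertAt∣ U r b) ⟩
  𝟙 c + (𝟙 b + ∣ U ∣)        ≡⟨ x∙yz≈y∙xz (𝟙 c) (𝟙 b) ∣ U ∣ ⟩
  𝟙 b + (𝟙 c + ∣ U ∣)        ≡⟨ cong (𝟙 b +_) (∣∷∣ c U) ⟨
  𝟙 b + ∣ c ∷ U ∣            ∎
  where open ≡-Reasoning

∣∁T∣+∣T∣≡n : ∀ {n} (T : Subset n) → ∣ ∁ T ∣ + ∣ T ∣ ≡ n
∣∁T∣+∣T∣≡n T = trans (cong (_+ ∣ T ∣) (∣∁p∣≡n∸∣p∣ T)) (m∸n+n≡m (∣p∣≤n T))

∈⇒∣T∣>0 : ∀ {n} (T : Subset n) y → lookup T y ≡ true → 1 ≤ ∣ T ∣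
∈⇒∣T∣>0 (true  ∷ T) y       y∈T = s≤s z≤n
∈⇒∣T∣>0 (false ∷ T) (suc y) y∈T = ∈⇒∣T∣>0 T y y∈T

∣T∣>0⇒∈ : ∀ {n} (T : Subset n) → 1 ≤ ∣ T ∣ → ∃ λ y → lookup T y ≡ true
∣T∣>0⇒∈ (true  ∷ T) _ = zero , refl
∣T∣>0⇒∈ (false ∷ T) ∣T∣>0 = let y , y∈T = ∣T∣>0⇒∈ T ∣T∣>0 in suc y , y∈T

∣T∣<n⇒∉ : ∀ {n} (T : Subset n) → ∣ T ∣ < n → ∃ λ y → lookup T y ≡ false
∣T∣<n⇒∉ (false ∷ T) _ = zero , refl
∣T∣<n⇒∉ (true  ∷ T) (s≤s ∣T∣<n) = let y , y∉T = ∣T∣<n⇒∉ T ∣T∣<n in suc y , y∉T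

∣T∣≡1⇒∈-unique : ∀ {n} (T : Subset n) {p q} → ∣ T ∣ ≡ 1 → lookup T p ≡ true → lookup T q ≡ true → p ≡ q
∣T∣≡1⇒∈-unique (b ∷ T) {zero} {zero} _ _ _ = refl
∣T∣≡1⇒∈-unique (true ∷ T) {zero} {suc q} ∣T∣≡1 _ q∈T =
  ⊥-elim (1+n≰n (subst (1 ≤_) (suc-injective ∣T∣≡1) (∈⇒∣T∣>0 T q q∈T)))
∣T∣≡1⇒∈-unique (true ∷ T) {suc p} ∣T∣≡1 p∈T _ =
  ⊥-elim (1+n≰n (subst (1 ≤_) (suc-injective ∣T∣≡1) (∈⇒∣T∣>0 T p p∈T)))
∣T∣≡1⇒∈-unique (false ∷ T) {suc p} {suc q} ∣T∣≡1 p∈T q∈T = cong suc (∣T∣≡1⇒∈-unique T ∣T∣≡1 p∈T q∈T)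

meets : ∀ {n} → Subset n → Subset n → Bool
meets []      []      = false
meets (a ∷ X) (b ∷ Y) = (a ∧ b) ∨ meets X Y

meets-sym : ∀ {n} (T U : Subset n) → meets T U ≡ meets U T
meets-sym []      []      = refl
meets-sym (t ∷ T) (u ∷ U) = cong₂ _∨_ (∧-comm t u) (meets-sym T U)

meets-∅ : ∀ {n} (T : Subset n) → meets T ∅ ≡ false
meets-∅ []      = refl
meets-∅ (t ∷ T) rewrite ∧-zeroʳ t = meets-∅ T

meets-∁ : ∀ {n} (T : Subset n) → meets (∁ T) T ≡ false
meets-∁ []          = refl
meets-∁ (true  ∷ T) = meets-∁ T
meets-∁ (false ∷ T) = meets-∁ T

meets-∷ : ∀ {n} b c (T U : Subset n) → meets T U ≡ true → meets (b ∷ T) (c ∷ U) ≡ true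
meets-∷ b c T U T∩U rewrite T∩U = ∨-zeroʳ (b ∧ c)

meets-intro : ∀ {n} (T U : Subset n) y → lookup T y ≡ true → lookup U y ≡ true → meets T U ≡ true
meets-intro (t ∷ T) (u ∷ U) zero    refl refl = refl
meets-intro (t ∷ T) (u ∷ U) (suc y) y∈T y∈U = meets-∷ t u T U (meets-intro T U y y∈T y∈U)

meets-elim : ∀ {n} (T U : Subset n) → meets T U ≡ true → ∃ λ y → lookup T y ≡ true × lookup U y ≡ true
meets-elim []          []          ()
meets-elim (true  ∷ T) (true  ∷ U) _ = zero , refl , refl
meets-elim (false ∷ T) (u     ∷ U) T∩U = let y , y∈T , y∈U = meets-elim T U T∩U in suc y , y∈T , y∈U
meets-elim (true  ∷ T) (false ∷ U) T∩U = let y , y∈T , y∈U = meets-elim T U T∩U in suc y , y∈T , y∈U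

meets-insertAt : ∀ {n} (U V : Subset n) r a b → meets (insertAt U r a) (insertAt V r b) ≡ (a ∧ b) ∨ meets U V
meets-insertAt U       V       zero    a b = refl
meets-insertAt (c ∷ U) (d ∷ V) (suc r) a b =
  trans (cong ((c ∧ d) ∨_) (meets-insertAt U V r a b)) (x∨[y∨z]≡y∨[x∨z] (c ∧ d) (a ∧ b) (meets U V))

meets-[]≔ : ∀ {n} (T U : Subset n) y b c →
            (lookup T y ∧ lookup U y) ∨ meets (T [ y ]≔ b) (U [ y ]≔ c) ≡ (b ∧ c) ∨ meets T U
meets-[]≔ (t ∷ T) (u ∷ U) zero    b c = x∨[y∨z]≡y∨[x∨z] (t ∧ u) (b ∧ c) (meets T U)
meets-[]≔ (t ∷ T) (u ∷ U) (suc y) b c = begin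
  (lookup T y ∧ lookup U y) ∨ ((t ∧ u) ∨ meets (T [ y ]≔ b) (U [ y ]≔ c))
    ≡⟨ x∨[y∨z]≡y∨[x∨z] (lookup T y ∧ lookup U y) (t ∧ u) _ ⟩
  (t ∧ u) ∨ ((lookup T y ∧ lookup U y) ∨ meets (T [ y ]≔ b) (U [ y ]≔ c))
    ≡⟨ cong ((t ∧ u) ∨_) (meets-[]≔ T U y b c) ⟩
  (t ∧ u) ∨ ((b ∧ c) ∨ meets T U)
    ≡⟨ x∨[y∨z]≡y∨[x∨z] (t ∧ u) (b ∧ c) (meets T U) ⟩
  (b ∧ c) ∨ ((t ∧ u) ∨ meets T U) ∎
  where open ≡-Reasoning

meets-swap₀ : ∀ {n} (y : Fin n) X Y → meets (swap₀ y X) (swap₀ y Y) ≡ meets X Y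
meets-swap₀ y (b ∷ T) (c ∷ U) = meets-[]≔ T U y b c

meets-[]≔-outside : ∀ {n} (T U : Subset n) y b → lookup U y ≡ false → meets (T [ y ]≔ b) U ≡ meets T U
meets-[]≔-outside (t ∷ T) (u ∷ U) zero    b refl rewrite ∧-zeroʳ b | ∧-zeroʳ t = refl
meets-[]≔-outside (t ∷ T) (u ∷ U) (suc y) b y∉U = cong ((t ∧ u) ∨_) (meets-[]≔-outside T U y b y∉U)

∣T∣+∣U∣<n⇒∉-both : ∀ {n} (T U : Subset n) → ∣ T ∣ + ∣ U ∣ < n →
                                ∃ λ y → lookup T y ≡ false × lookup U y ≡ false
∣T∣+∣U∣<n⇒∉-both (false ∷ T) (false ∷ U) _ = zero , refl , refl
∣T∣+∣U∣<n⇒∉-both (true ∷ T) (u ∷ U) (s≤s ∣T∣+∣U∣<n) =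
  let y , y∉T , y∉U = ∣T∣+∣U∣<n⇒∉-both T U
                        (≤-trans (s≤s (+-monoʳ-≤ ∣ T ∣ (∣p∣≤∣x∷p∣ u U))) ∣T∣+∣U∣<n)
  in suc y , y∉T , y∉U
∣T∣+∣U∣<n⇒∉-both {suc n} (false ∷ T) (true ∷ U) ∣T∣+∣U∣<n =
  let y , y∉T , y∉U = ∣T∣+∣U∣<n⇒∉-both T U
                        (s≤s⁻¹ (subst (_< suc n) (+-suc ∣ T ∣ ∣ U ∣) ∣T∣+∣U∣<n))
  in suc y , y∉T , y∉U

Layer : ∀ {n} → ℕ → Family n
Layer j T = ∣ T ∣ ≡ᵇ j

card-Layer-avoiding : ∀ {n} j (G : Subset n) → card (λ T → Layer j T ∧ not (meets T G)) ≡ (n ∸ ∣ G ∣) C j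
card-Layer-avoiding zero    []          = refl
card-Layer-avoiding (suc j) []          = refl
card-Layer-avoiding j       (true ∷ G)  =
  trans (cong₂ _+_ (card-Layer-avoiding j G)
                   (card-empty (link₀ (λ T → Layer j T ∧ not (meets T (true ∷ G))))
                               (λ T → ∧-zeroʳ (Layer j (true ∷ T)))))
        (+-identityʳ _)
card-Layer-avoiding zero    (false ∷ G) =
  cong₂ _+_ (card-Layer-avoiding zero G)
            (card-empty (link₀ (λ T → Layer zero T ∧ not (meets T (false ∷ G)))) (λ _ → refl))
card-Layer-avoiding {suc n} (suc j) (false ∷ G) = begin
  card (λ T → Layer (suc j) T ∧ not (meets T (false ∷ G)))
    ≡⟨ cong₂ _+_ (card-Layer-avoiding (suc j) G) (card-Layer-avoiding j G) ⟩
  (n ∸ ∣ G ∣) C suc j + (n ∸ ∣ G ∣) C j ≡⟨ +-comm ((n ∸ ∣ G ∣) C suc j) _ ⟩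
  (n ∸ ∣ G ∣) C j + (n ∸ ∣ G ∣) C suc j ≡⟨ nCk+nC[k+1]≡[n+1]C[k+1] (n ∸ ∣ G ∣) j ⟩
  suc (n ∸ ∣ G ∣) C suc j                ≡⟨ cong (_C suc j) (+-∸-assoc 1 (∣p∣≤n G)) ⟨
  (suc n ∸ ∣ G ∣) C suc j                ∎
  where open ≡-Reasoning

∈-Layer : ∀ {n j} (T : Subset n) → ∣ T ∣ ≡ j → Layer j T ≡ true
∈-Layer {j = j} T refl = Equivalence.to T-≡ (≡⇒≡ᵇ j j refl)

card-Layer : ∀ n j → card (Layer {n} j) ≡ n C j
card-Layer n j = begin
  card (Layer {n} j)                            ≡⟨ card-cong {n} (λ T → ∧-identityʳ (Layer j T)) ⟨
  card {n} (λ T → Layer j T ∧ true)             ≡⟨ card-cong {n} (λ T → cong (λ b → Layer j T ∧ not b) (meets-∅ T)) ⟨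
  card {n} (λ T → Layer j T ∧ not (meets T ∅))  ≡⟨ card-Layer-avoiding j (∅ {n}) ⟩
  (n ∸ ∣ ∅ {n} ∣) C j                           ≡⟨ cong (λ m → (n ∸ m) C j) (∣⊥∣≡0 n) ⟩
  n C j                                         ∎
  where open ≡-Reasoning

card-Layer-meeting : ∀ {n} j (G : Subset n) → card (λ T → Layer j T ∧ meets T G) + (n ∸ ∣ G ∣) C j ≡ n C j
card-Layer-meeting {n} j G = begin
  card {n} (λ T → Layer j T ∧ meets T G) + (n ∸ ∣ G ∣) C j
    ≡⟨ cong (card (λ T → Layer j T ∧ meets T G) +_) (card-Layer-avoiding j G) ⟨
  card (λ T → Layer j T ∧ meets T G) + card (λ T → Layer j T ∧ not (meets T G))
    ≡⟨ card-split (Layer j) (λ T → meets T G) ⟨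
  card (Layer {n} j)
    ≡⟨ card-Layer n j ⟩
  n C j ∎
  where open ≡-Reasoning

insertAt-removeAt′ : ∀ {n} (T : Subset (suc n)) r {b} → lookup T r ≡ b → insertAt (removeAt T r) r b ≡ T
insertAt-removeAt′ T r refl = insertAt-removeAt T r

card-through : ∀ {n} (F : Family (suc n)) r → (∀ X → F X ≡ true → lookup X r ≡ true) →
               card F ≡ card (λ U → F (insertAt U r true))
card-through F r F∋r =
  trans (∑-insertAt r (𝟙 ∘ F)) (cong (_+ card (λ U → F (insertAt U r true))) (card-empty _ misses-r))
  where
  misses-r : ∀ U → F (insertAt U r false) ≡ false
  misses-r U with F (insertAt U r false) in FU
  ... | false = refl
  ... | true  = case trans (sym (insertAt-lookup U r false)) (F∋r _ FU) of λ ()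

-- Intersecting families and shifting

CrossIntersecting : ∀ {n} → Family n → Family n → Set
CrossIntersecting A B = ∀ X Y → A X ≡ true → B Y ≡ true → meets X Y ≡ true

Intersecting : ∀ {n} → Family n → Set
Intersecting F = CrossIntersecting F F

Uniform : ∀ {n} → ℕ → Family n → Set
Uniform k F = ∀ X → F X ≡ true → ∣ X ∣ ≡ k

-- The shift replaces 0 by y+1 in every member that contains 0 but not y+1,
-- unless the resulting set is already a member.
shift : ∀ {n} → Fin n → Family (suc n) → Family (suc n)
shift y F (true  ∷ T) = if lookup T y then F (true ∷ T) else F (true ∷ T) ∧ F (swap₀ y (true ∷ T))
shift y F (false ∷ T) = if lookup T y then F (false ∷ T) ∨ F (swap₀ y (false ∷ T)) else F (false ∷ T)

2*m≡m+m : ∀ m → 2 * m ≡ m + m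
2*m≡m+m m = cong (m +_) (+-identityʳ m)

module _ {n} (y : Fin n) (F : Family (suc n)) where

  shift-fixed : ∀ b T → lookup T y ≡ b → shift y F (b ∷ T) ≡ F (b ∷ T)
  shift-fixed true  T Ty rewrite Ty = refl
  shift-fixed false T Ty rewrite Ty = refl

  shift-out : ∀ T → lookup T y ≡ false → shift y F (true ∷ T) ≡ F (true ∷ T) ∧ F (false ∷ T [ y ]≔ true)
  shift-out T y∉T rewrite y∉T = refl

  shift-in : ∀ T → lookup T y ≡ true → shift y F (false ∷ T) ≡ F (false ∷ T) ∨ F (true ∷ T [ y ]≔ false)
  shift-in T y∈T rewrite y∈T = refl

  𝟙-shift-pair : ∀ X → 𝟙 (shift y F X) + 𝟙 (shift y F (swap₀ y X)) ≡ 𝟙 (F X) + 𝟙 (F (swap₀ y X))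
  𝟙-shift-pair (b ∷ T) = pair b (lookup T y) refl
    where
    pair : ∀ b c → lookup T y ≡ c →
           𝟙 (shift y F (b ∷ T)) + 𝟙 (shift y F (swap₀ y (b ∷ T))) ≡ 𝟙 (F (b ∷ T)) + 𝟙 (F (swap₀ y (b ∷ T)))
    pair true true Ty rewrite swap₀-fixed y true T Ty | Ty = refl
    pair false false Ty rewrite swap₀-fixed y false T Ty | Ty = refl
    pair true false Ty
      rewrite Ty | shift-in (T [ y ]≔ true) (lookup∘update y T true)
            | []≔-idempotent {x = true} {y = false} T y | []≔-self T y Ty
      = 𝟙-∧-∨ (F (true ∷ T)) (F (false ∷ T [ y ]≔ true))
      where
      𝟙-∧-∨ : ∀ a b → 𝟙 (a ∧ b) + 𝟙 (b ∨ a) ≡ 𝟙 a + 𝟙 b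
      𝟙-∧-∨ false false = refl
      𝟙-∧-∨ false true  = refl
      𝟙-∧-∨ true  false = refl
      𝟙-∧-∨ true  true  = refl
    pair false true Ty
      rewrite Ty | shift-out (T [ y ]≔ false) (lookup∘update y T false)
            | []≔-idempotent {x = false} {y = true} T y | []≔-self T y Ty
      = 𝟙-∨-∧ (F (false ∷ T)) (F (true ∷ T [ y ]≔ false))
      where
      𝟙-∨-∧ : ∀ a b → 𝟙 (a ∨ b) + 𝟙 (b ∧ a) ≡ 𝟙 a + 𝟙 b
      𝟙-∨-∧ false false = refl
      𝟙-∨-∧ false true  = refl
      𝟙-∨-∧ true  false = refl
      𝟙-∨-∧ true  true  = refl

  -- Summing 𝟙-shift-pair counts every set twice, once as X and once as swap₀ y X.
  card-shift : card (shift y F) ≡ card F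
  card-shift = *-cancelˡ-≡ _ _ 2 (begin
    2 * card (shift y F)                                    ≡⟨ 2*m≡m+m (card (shift y F)) ⟩
    card (shift y F) + card (shift y F)
      ≡⟨ cong (card (shift y F) +_) (∑-swap₀ y (𝟙 ∘ shift y F)) ⟨
    card (shift y F) + ∑ (𝟙 ∘ shift y F ∘ swap₀ y)
      ≡⟨ ∑-distrib-+ (𝟙 ∘ shift y F) (𝟙 ∘ shift y F ∘ swap₀ y) ⟨
    ∑ (λ X → 𝟙 (shift y F X) + 𝟙 (shift y F (swap₀ y X)))  ≡⟨ ∑-cong 𝟙-shift-pair ⟩
    ∑ (λ X → 𝟙 (F X) + 𝟙 (F (swap₀ y X)))                  ≡⟨ ∑-distrib-+ (𝟙 ∘ F) (𝟙 ∘ F ∘ swap₀ y) ⟩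
    card F + ∑ (𝟙 ∘ F ∘ swap₀ y)                            ≡⟨ cong (card F +_) (∑-swap₀ y (𝟙 ∘ F)) ⟩
    card F + card F                                         ≡⟨ 2*m≡m+m (card F) ⟨
    2 * card F                                              ∎)
    where open ≡-Reasoning

  shift-keeps-avoid₀ : ∀ T → avoid₀ F T ≡ true → avoid₀ (shift y F) T ≡ true
  shift-keeps-avoid₀ T F₀T with lookup T y
  ... | true  rewrite F₀T = refl
  ... | false = F₀T

  shift-shrinks-link₀ : ∀ T → link₀ (shift y F) T ≡ true → link₀ F T ≡ true
  shift-shrinks-link₀ T sF₁T with lookup T y | F (true ∷ T)
  ... | true  | _    = sF₁T
  ... | false | true = refl

  shift-member : ∀ b T → shift y F (b ∷ T) ≡ true →
                 F (b ∷ T) ≡ true ⊎ (lookup T y ≡ true × F (swap₀ y (b ∷ T)) ≡ true)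
  shift-member true T sFX with lookup T y | F (true ∷ T)
  ... | true  | _    = inj₁ sFX
  ... | false | true = inj₁ refl
  shift-member false T sFX with lookup T y | F (false ∷ T)
  ... | false | _    = inj₁ sFX
  ... | true  | true = inj₁ refl
  ... | true  | false = inj₂ (refl , sFX)

  shift-member-∉ : ∀ b T → shift y F (b ∷ T) ≡ true → lookup T y ≡ false → F (swap₀ y (b ∷ T)) ≡ true
  shift-member-∉ true  T sFX y∉T =
    subst (λ c → F (c ∷ T [ y ]≔ true) ≡ true) (sym y∉T)
          (∧-conicalʳ (F (true ∷ T)) _ (trans (sym (shift-out T y∉T)) sFX))
  shift-member-∉ false T sFX y∉T =
    trans (cong F (swap₀-fixed y false T y∉T)) (trans (sym (shift-fixed false T y∉T)) sFX)

  shift-removed : ∀ Z → F Z ≡ true → shift y F Z ≡ false →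
                  ∃ λ U → Z ≡ true ∷ U × avoid₀ (shift y F) (U [ y ]≔ true) ≡ true
  shift-removed (false ∷ T) FZ sFZ = case trans (sym sFZ) (shift-keeps-avoid₀ T FZ) of λ ()
  shift-removed (true  ∷ T) FZ sFZ with lookup T y in Ty
  ... | true  = case trans (sym sFZ) FZ of λ ()
  ... | false = T , refl , (begin
    shift y F (false ∷ T [ y ]≔ true)                   ≡⟨ shift-in (T [ y ]≔ true) (lookup∘update y T true) ⟩
    F (false ∷ T [ y ]≔ true) ∨ F (true ∷ (T [ y ]≔ true) [ y ]≔ false)
      ≡⟨ cong (λ U → F (false ∷ T [ y ]≔ true) ∨ F (true ∷ U)) ([]≔-idempotent T y) ⟩
    F (false ∷ T [ y ]≔ true) ∨ F (true ∷ T [ y ]≔ false)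
      ≡⟨ cong (λ U → F (false ∷ T [ y ]≔ true) ∨ F (true ∷ U)) ([]≔-self T y Ty) ⟩
    F (false ∷ T [ y ]≔ true) ∨ F (true ∷ T)             ≡⟨ cong (F (false ∷ T [ y ]≔ true) ∨_) FZ ⟩
    F (false ∷ T [ y ]≔ true) ∨ true                      ≡⟨ ∨-zeroʳ _ ⟩
    true                                                  ∎)
    where open ≡-Reasoning

Shifted : ∀ {n} → Fin n → Family (suc n) → Set
Shifted y F = ∀ T → link₀ F T ≡ true → lookup T y ≡ false → avoid₀ F (T [ y ]≔ true) ≡ true

shift-Shifted : ∀ {n} (y : Fin n) F → Shifted y (shift y F)
shift-Shifted y F T sF₁T y∉T =
  trans (shift-in y F (T [ y ]≔ true) (lookup∘update y T true))
        (cong (_∨ F (true ∷ (T [ y ]≔ true) [ y ]≔ false))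
              (∧-conicalʳ (F (true ∷ T)) _ (trans (sym (shift-out y F T y∉T)) sF₁T)))

shift-preserves-Shifted : ∀ {n} (y z : Fin n) F → Shifted z F → Shifted z (shift y F)
shift-preserves-Shifted y z F shifted T sF₁T z∉T =
  shift-keeps-avoid₀ y F (T [ z ]≔ true) (shifted T (shift-shrinks-link₀ y F T sF₁T) z∉T)

shift-CrossIntersecting : ∀ {n} (y : Fin n) A B → CrossIntersecting A B →
                          CrossIntersecting (shift y A) (shift y B)
shift-CrossIntersecting y A B A×B (b ∷ T) (c ∷ U) sAX sBY
  with shift-member y A b T sAX | shift-member y B c U sBY
... | inj₁ AX | inj₁ BY = A×B _ _ AX BY
... | inj₁ AX | inj₂ (y∈U , BsY) with lookup T y in Ty
...   | true  = meets-∷ b c T U (meets-intro T U y Ty y∈U)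
...   | false = trans (sym (meets-swap₀ y (b ∷ T) (c ∷ U))) (A×B _ _ (shift-member-∉ y A b T sAX Ty) BsY)
shift-CrossIntersecting y A B A×B (b ∷ T) (c ∷ U) sAX sBY | inj₂ (y∈T , AsX) | _ with lookup U y in Uy
...   | true  = meets-∷ b c T U (meets-intro T U y y∈T Uy)
...   | false = trans (sym (meets-swap₀ y (b ∷ T) (c ∷ U))) (A×B _ _ AsX (shift-member-∉ y B c U sBY Uy))

shift-Uniform : ∀ {n} (y : Fin n) k F → Uniform k F → Uniform k (shift y F)
shift-Uniform y k F uniform (b ∷ T) sFX with shift-member y F b T sFX
... | inj₁ FX       = uniform _ FX
... | inj₂ (_ , FsX) = trans (sym (∣swap₀∣ y (b ∷ T))) (uniform _ FsX)

shiftAll : ∀ {n} → List (Fin n) → Family (suc n) → Family (suc n)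
shiftAll []       F = F
shiftAll (y ∷ ys) F = shift y (shiftAll ys F)

card-shiftAll : ∀ {n} (ys : List (Fin n)) F → card (shiftAll ys F) ≡ card F
card-shiftAll []       F = refl
card-shiftAll (y ∷ ys) F = trans (card-shift y (shiftAll ys F)) (card-shiftAll ys F)

shiftAll-CrossIntersecting : ∀ {n} (ys : List (Fin n)) A B → CrossIntersecting A B →
                             CrossIntersecting (shiftAll ys A) (shiftAll ys B)
shiftAll-CrossIntersecting []       A B A×B = A×B
shiftAll-CrossIntersecting (y ∷ ys) A B A×B =
  shift-CrossIntersecting y (shiftAll ys A) (shiftAll ys B) (shiftAll-CrossIntersecting ys A B A×B)

shiftAll-Uniform : ∀ {n} (ys : List (Fin n)) k F → Uniform k F → Uniform k (shiftAll ys F)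
shiftAll-Uniform []       k F uniform = uniform
shiftAll-Uniform (y ∷ ys) k F uniform = shift-Uniform y k (shiftAll ys F) (shiftAll-Uniform ys k F uniform)

shiftAll-Shifted : ∀ {n} (ys : List (Fin n)) F → ∀ y → y ∈ ys → Shifted y (shiftAll ys F)
shiftAll-Shifted (y ∷ ys) F .y (here refl) = shift-Shifted y (shiftAll ys F)
shiftAll-Shifted (y ∷ ys) F z  (there z∈ys) =
  shift-preserves-Shifted y z (shiftAll ys F) (shiftAll-Shifted ys F z z∈ys)

Trivial : ∀ {n} → Family n → Set
Trivial {n} F = ∃ λ (p : Fin n) → ∀ X → F X ≡ true → lookup X p ≡ true

Escapes : ∀ {n} → Family n → Fin n → Set
Escapes F p = ∃ λ X → F X ≡ true × lookup X p ≡ false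

escapes? : ∀ {n} (F : Family n) p → Dec (Escapes F p)
escapes? F p = anySubset? (λ X → (F X ≟𝔹 true) ×-dec (lookup X p ≟𝔹 false))

¬Escapes⇒∈ : ∀ {n} {F : Family n} {p} → ¬ Escapes F p → ∀ X → F X ≡ true → lookup X p ≡ true
¬Escapes⇒∈ {p = p} ¬escapes X FX with lookup X p in Xp
... | true  = refl
... | false = ⊥-elim (¬escapes (X , FX , Xp))

trivial? : ∀ {n} (F : Family n) → Dec (Trivial F)
trivial? F with Fin.any? (¬? ∘ escapes? F)
... | yes (p , ¬escapes) = yes (p , ¬Escapes⇒∈ ¬escapes)
... | no  ¬trivial       = no λ (p , F∋p) →
  ¬trivial (p , λ (X , FX , Xp) → case trans (sym (F∋p X FX)) Xp of λ ())

¬Trivial⇒Escapes : ∀ {n} {F : Family n} → ¬ Trivial F → ∀ p → Escapes F p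
¬Trivial⇒Escapes {F = F} nontrivial p with escapes? F p
... | yes escapes  = escapes
... | no ¬escapes  = ⊥-elim (nontrivial (p , ¬Escapes⇒∈ ¬escapes))

Intersecting-Uniform1⇒Trivial : ∀ {n} (F : Family (suc n)) → Intersecting F → Uniform 1 F → Trivial F
Intersecting-Uniform1⇒Trivial F intersecting uniform with card F ≟ℕ 0
... | yes ∣F∣≡0 = zero , λ X FX → case trans (sym FX) (card≡0⇒∉ F ∣F∣≡0 X) of λ ()
... | no  ∣F∣≢0 with card-witness F (n≢0⇒n>0 ∣F∣≢0)
... | X , FX with ∣T∣>0⇒∈ X (≤-reflexive (sym (uniform X FX)))
... | p , p∈X = p , λ Y FY → through-p Y (meets-elim X Y (intersecting X Y FX FY))
  where
  through-p : ∀ Y → (∃ λ q → lookup X q ≡ true × lookup Y q ≡ true) → lookup Y p ≡ true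
  through-p Y (q , q∈X , q∈Y) rewrite ∣T∣≡1⇒∈-unique X (uniform X FX) p∈X q∈X = q∈Y

CrossIntersecting-Uniform0⇒empty : ∀ {m} (A B : Family m) → CrossIntersecting A B → Uniform 0 A →
                                   1 ≤ card A → 1 ≤ card B → ⊥
CrossIntersecting-Uniform0⇒empty A B A×B uniform ∣A∣>0 ∣B∣>0 with card-witness A ∣A∣>0 | card-witness B ∣B∣>0
... | X , AX | Y , BY with meets-elim X Y (A×B X Y AX BY)
... | y , y∈X , _ = 1+n≰n (subst (1 ≤_) (uniform X AX) (∈⇒∣T∣>0 X y y∈X))

Uniform-∁ : ∀ {n} j k (F : Family n) → Uniform j F → j + k ≡ n → Uniform k (F ∘ ∁)
Uniform-∁ j k F uniform j+k≡n T F∁T = +-cancelˡ-≡ j _ _ (begin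
  j + ∣ T ∣          ≡⟨ cong (_+ ∣ T ∣) (uniform (∁ T) F∁T) ⟨
  ∣ ∁ T ∣ + ∣ T ∣    ≡⟨ ∣∁T∣+∣T∣≡n T ⟩
  _                  ≡⟨ j+k≡n ⟨
  j + k              ∎)
  where open ≡-Reasoning

-- A j-set T is counted through A T or through B (∁ T), never both since T misses ∁ T.
CrossIntersecting-complementary-bound : ∀ {m} j k (A B : Family m) → CrossIntersecting A B →
                                        Uniform j A → Uniform k B → j + k ≡ m → card A + card B ≤ m C j
CrossIntersecting-complementary-bound {m} j k A B A×B uniformA uniformB j+k≡m = begin
  card A + card B                                     ≡⟨ cong (card A +_) (∑-∁ (𝟙 ∘ B)) ⟨
  card A + card (B ∘ ∁)                               ≡⟨ card-∪ A (B ∘ ∁) ⟨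
  card (λ T → A T ∨ B (∁ T)) + card (λ T → A T ∧ B (∁ T))
    ≡⟨ cong (card (λ T → A T ∨ B (∁ T)) +_) (card-empty (λ T → A T ∧ B (∁ T)) never-both) ⟩
  card (λ T → A T ∨ B (∁ T)) + 0                      ≡⟨ +-identityʳ _ ⟩
  card (λ T → A T ∨ B (∁ T))                          ≤⟨ card-mono ∪⊆Layer ⟩
  card (Layer {m} j)                                  ≡⟨ card-Layer m j ⟩
  m C j                                               ∎
  where
  open ≤-Reasoning
  never-both : ∀ T → A T ∧ B (∁ T) ≡ false
  never-both T with A T in AT | B (∁ T) in B∁T
  ... | false | _     = refl
  ... | true  | false = refl
  ... | true  | true  = case trans (sym (A×B T (∁ T) AT B∁T)) (trans (meets-sym T (∁ T)) (meets-∁ T)) of λ ()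
  ∪⊆Layer : ∀ T → A T ∨ B (∁ T) ≡ true → Layer j T ≡ true
  ∪⊆Layer T A∨B∁ with A T in AT
  ... | true  = ∈-Layer T (uniformA T AT)
  ... | false = ∈-Layer T (Uniform-∁ k j B uniformB (trans (+-comm k j) j+k≡m) T A∨B∁)

nCk>0 : ∀ {n k} → k ≤ n → 0 < n C k
nCk>0 {n}     {zero}  _         = s≤s z≤n
nCk>0 {suc n} {suc k} (s≤s k≤n) =
  subst (0 <_) (nCk+nC[k+1]≡[n+1]C[k+1] n k) (<-≤-trans (nCk>0 k≤n) (m≤m+n _ _))

∸-suc : ∀ {m n} → n < m → m ∸ n ≡ suc (m ∸ suc n)
∸-suc n<m = +-∸-assoc 1 n<m

-- Removing one more point from the subtracted binomial costs at least one set, by Pascal's rule.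
drop-point : ∀ c m s k Y → suc s + k ≤ m → c + (m ∸ s) C suc k ≤ Y + 1 → c + (m ∸ suc s) C suc k ≤ Y
drop-point c m s k Y 1+s+k≤m bound = +-cancelʳ-≤ 1 _ _ (begin
  c + a C suc k + 1             ≡⟨ +-assoc c _ 1 ⟩
  c + (a C suc k + 1)           ≡⟨ cong (c +_) (+-comm _ 1) ⟩
  c + (1 + a C suc k)           ≤⟨ +-monoʳ-≤ c (+-monoˡ-≤ (a C suc k) (nCk>0 k≤a)) ⟩
  c + (a C k + a C suc k)       ≡⟨ cong (c +_) (nCk+nC[k+1]≡[n+1]C[k+1] a k) ⟩
  c + suc a C suc k             ≡⟨ cong (λ x → c + x C suc k) (∸-suc s<m) ⟨
  c + (m ∸ s) C suc k           ≤⟨ bound ⟩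
  Y + 1                         ∎)
  where
  open ≤-Reasoning
  a : ℕ
  a = m ∸ suc s
  s<m : s < m
  s<m = ≤-trans (m≤m+n (suc s) k) 1+s+k≤m
  k≤a : k ≤ a
  k≤a = m+n≤o⇒m≤o∸n k (subst (_≤ m) (+-comm (suc s) k) 1+s+k≤m)

pascal+1 : ∀ m k → (m C suc k + 1) + m C k ≡ suc m C suc k + 1
pascal+1 m k = trans (regroup (m C suc k) (m C k)) (cong (_+ 1) (nCk+nC[k+1]≡[n+1]C[k+1] m k))
  where
  regroup : ∀ X Y → (X + 1) + Y ≡ (Y + X) + 1
  regroup = solve 2 (λ X Y → (X :+ con 1) :+ Y := (Y :+ X) :+ con 1) refl

-- The bounds for the members avoiding and containing a point add up by Pascal's rule.
pascal-combine : ∀ c₀ c₁ a m k → c₀ + a C suc k ≤ m C suc k + 1 → c₁ + a C k ≤ m C k →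
                 c₀ + c₁ + suc a C suc k ≤ suc m C suc k + 1
pascal-combine c₀ c₁ a m k bound₀ bound₁ = begin
  c₀ + c₁ + suc a C suc k                ≡⟨ cong (c₀ + c₁ +_) (nCk+nC[k+1]≡[n+1]C[k+1] a k) ⟨
  c₀ + c₁ + (a C k + a C suc k)          ≡⟨ regroup c₀ c₁ (a C k) (a C suc k) ⟩
  (c₀ + a C suc k) + (c₁ + a C k)        ≤⟨ +-mono-≤ bound₀ bound₁ ⟩
  (m C suc k + 1) + m C k                ≡⟨ pascal+1 m k ⟩
  suc m C suc k + 1                      ∎
  where
  open ≤-Reasoning
  regroup : ∀ c₀ c₁ y x → c₀ + c₁ + (y + x) ≡ (c₀ + x) + (c₁ + y)
  regroup = solve 4 (λ c₀ c₁ y x → c₀ :+ c₁ :+ (y :+ x) := (c₀ :+ x) :+ (c₁ :+ y)) refl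

-- Cross-intersecting families

AllShifted : ∀ {n} → Family (suc n) → Set
AllShifted F = ∀ y → Shifted y F

shiftAll-AllShifted : ∀ {n} (F : Family (suc n)) → AllShifted (shiftAll (allFin n) F)
shiftAll-AllShifted F y = shiftAll-Shifted (allFin _) F y (∈-allFin y)

AllShifted⇒avoid₀-nonempty : ∀ {m} l (F : Family (suc m)) → AllShifted F → Uniform (suc l) F → l < m →
                             1 ≤ card F → 1 ≤ card (avoid₀ F)
AllShifted⇒avoid₀-nonempty l F shifted uniform l<m ∣F∣>0 with card-witness F ∣F∣>0
... | false ∷ T , FX = card-pos (avoid₀ F) T FX
... | true  ∷ T , FX with ∣T∣<n⇒∉ T (subst (_< _) (sym (suc-injective (uniform _ FX))) l<m)
... | y , y∉T = card-pos (avoid₀ F) (T [ y ]≔ true) (shifted y T FX y∉T)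

-- Two disjoint l-sets leave a point y free; shifting 0 to y in one of them gives a member
-- of A avoiding 0 that still misses the other set.
AllShifted⇒link₀-CrossIntersecting : ∀ {m} l (A B : Family (suc m)) → AllShifted A → CrossIntersecting A B →
                                     Uniform (suc l) A → Uniform (suc l) B → l + l < m →
                                     CrossIntersecting (link₀ A) (link₀ B)
AllShifted⇒link₀-CrossIntersecting {m} l A B shifted A×B uniformA uniformB l+l<m T U A₁T B₁U
  with meets T U in T∩U
... | true  = refl
... | false with ∣T∣+∣U∣<n⇒∉-both T U (subst (_< m) (sym ∣T∣+∣U∣≡l+l) l+l<m)
  where
  ∣T∣+∣U∣≡l+l : ∣ T ∣ + ∣ U ∣ ≡ l + l
  ∣T∣+∣U∣≡l+l = cong₂ _+_ (suc-injective (uniformA _ A₁T)) (suc-injective (uniformB _ B₁U))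
... | y , y∉T , y∉U = case trans (sym T∩U) meet of λ ()
  where
  meet : meets T U ≡ true
  meet = trans (sym (meets-[]≔-outside T U y true y∉U)) (A×B _ (true ∷ U) (shifted y T A₁T y∉T) B₁U)

card-meeting-bound : ∀ {m} j (F : Family m) (G : Subset m) → (∀ T → F T ≡ true → ∣ T ∣ ≡ j × meets T G ≡ true) →
                     card F + (m ∸ ∣ G ∣) C j ≤ m C j
card-meeting-bound {m} j F G F⊆ = begin
  card F + (m ∸ ∣ G ∣) C j                                  ≤⟨ +-monoˡ-≤ _ (card-mono F⊆Layer∩) ⟩
  card (λ T → Layer j T ∧ meets T G) + (m ∸ ∣ G ∣) C j      ≡⟨ card-Layer-meeting j G ⟩
  m C j                                                      ∎
  where
  open ≤-Reasoning
  F⊆Layer∩ : ∀ T → F T ≡ true → Layer j T ∧ meets T G ≡ true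
  F⊆Layer∩ T FT with F⊆ T FT
  ... | ∣T∣≡j , T∩G rewrite ∈-Layer T ∣T∣≡j = T∩G

centred-meeting-bound : ∀ {n} k (H : Family (suc n)) p (S : Subset (suc n)) → lookup S p ≡ false →
                        (∀ T → H T ≡ true → lookup T p ≡ true) → Uniform (suc k) H →
                        (∀ T → H T ≡ true → meets T S ≡ true) → card H + (n ∸ ∣ S ∣) C k ≤ n C k
centred-meeting-bound {n} k H p S p∉S centred uniform H∩S = begin
  card H + (n ∸ ∣ S ∣) C k     ≡⟨ cong₂ (λ c s → c + (n ∸ s) C k) (card-through H p centred) (sym ∣S′∣≡∣S∣) ⟩
  card H′ + (n ∸ ∣ S′ ∣) C k   ≤⟨ card-meeting-bound k H′ S′ H′⊆ ⟩
  n C k                        ∎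
  where
  open ≤-Reasoning
  S′ : Subset n
  S′ = removeAt S p
  S′+p≡S : insertAt S′ p false ≡ S
  S′+p≡S = insertAt-removeAt′ S p p∉S
  ∣S′∣≡∣S∣ : ∣ S′ ∣ ≡ ∣ S ∣
  ∣S′∣≡∣S∣ = trans (sym (∣insertAt∣ S′ p false)) (cong ∣_∣ S′+p≡S)
  H′ : Family n
  H′ U = H (insertAt U p true)
  H′⊆ : ∀ U → H′ U ≡ true → ∣ U ∣ ≡ k × meets U S′ ≡ true
  H′⊆ U H′U = suc-injective (trans (sym (∣insertAt∣ U p true)) (uniform _ H′U))
            , trans (sym (meets-insertAt U S′ p true false))
                    (subst (λ X → meets (insertAt U p true) X ≡ true) (sym S′+p≡S) (H∩S _ H′U))

2*m≤n⇒m+m≤n : ∀ {m n} → 2 * m ≤ n → m + m ≤ n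
2*m≤n⇒m+m≤n {m} {n} = subst (_≤ n) (2*m≡m+m m)

CrossIntersectingBound : ℕ → Set
CrossIntersectingBound m = ∀ l → 2 * l ≤ m → (A B : Family m) → CrossIntersecting A B →
                           Uniform l A → Uniform l B → 1 ≤ card A → 1 ≤ card B →
                           card A + card B + (m ∸ l) C l ≤ m C l + 1

-- If one family is empty, the other is bounded by the l-sets meeting the given (l+1)-set;
-- otherwise induction on l applies.
link-pair-bound : ∀ m l → CrossIntersectingBound m → 2 * suc l ≤ m →
                  (A B : Family m) → CrossIntersecting A B → Uniform l A → Uniform l B →
                  (GA GB : Subset m) → ∣ GA ∣ ≡ suc l → ∣ GB ∣ ≡ suc l →
                  (∀ T → A T ≡ true → meets T GB ≡ true) → (∀ U → B U ≡ true → meets U GA ≡ true) →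
                  card A + card B + (m ∸ suc l) C l ≤ m C l
link-pair-bound m l IH 2l+2≤m A B A×B uniformA uniformB GA GB ∣GA∣ ∣GB∣ A∩GB B∩GA
  with card A ≟ℕ 0 | card B ≟ℕ 0
... | yes ∣A∣≡0 | _ rewrite ∣A∣≡0 | sym ∣GA∣ =
  card-meeting-bound l B GA (λ U BU → uniformB U BU , B∩GA U BU)
... | no _ | yes ∣B∣≡0 rewrite ∣B∣≡0 | +-identityʳ (card A) | sym ∣GB∣ =
  card-meeting-bound l A GB (λ T AT → uniformA T AT , A∩GB T AT)
... | no ∣A∣≢0 | no ∣B∣≢0 = both-nonempty l uniformA uniformB 2l+2≤m
  where
  both-nonempty : ∀ l′ → Uniform l′ A → Uniform l′ B → 2 * suc l′ ≤ m →
                  card A + card B + (m ∸ suc l′) C l′ ≤ m C l′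
  both-nonempty zero uniformA _ _ =
    ⊥-elim (CrossIntersecting-Uniform0⇒empty A B A×B uniformA (n≢0⇒n>0 ∣A∣≢0) (n≢0⇒n>0 ∣B∣≢0))
  both-nonempty (suc k) uniformA uniformB 2k+4≤m =
    drop-point (card A + card B) m (suc k) k (m C suc k)
      (≤-trans (+-monoʳ-≤ (suc (suc k)) (≤-trans (n≤1+n k) (n≤1+n (suc k)))) (2*m≤n⇒m+m≤n {suc (suc k)} 2k+4≤m))
      (IH (suc k) (≤-trans (*-monoʳ-≤ 2 (n≤1+n (suc k))) 2k+4≤m) A B A×B uniformA uniformB
          (n≢0⇒n>0 ∣A∣≢0) (n≢0⇒n>0 ∣B∣≢0))

cross-intersecting-balanced : ∀ m l → suc m ≡ 2 * suc l → (A B : Family (suc m)) → CrossIntersecting A B →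
                              Uniform (suc l) A → Uniform (suc l) B →
                              card A + card B + (m ∸ l) C suc l ≤ suc m C suc l + 1
cross-intersecting-balanced m l balanced A B A×B uniformA uniformB =
  subst (λ x → card A + card B + x ≤ suc m C suc l + 1) (sym (trans (cong (_C suc l) m∸l≡1+l) (nCn≡1 (suc l))))
        (+-monoˡ-≤ 1 (CrossIntersecting-complementary-bound (suc l) (suc l) A B A×B uniformA uniformB
                        (sym 1+m≡2+2l)))
  where
  1+m≡2+2l : suc m ≡ suc l + suc l
  1+m≡2+2l = trans balanced (2*m≡m+m (suc l))
  m∸l≡1+l : m ∸ l ≡ suc l
  m∸l≡1+l = trans (cong (_∸ l) (suc-injective 1+m≡2+2l)) (m+n∸m≡n l (suc l))

cross-intersecting-shifted : ∀ m l → CrossIntersectingBound m → 2 * suc l ≤ m → (A B : Family (suc m)) →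
                             AllShifted A → AllShifted B → CrossIntersecting A B →
                             Uniform (suc l) A → Uniform (suc l) B → 1 ≤ card A → 1 ≤ card B →
                             card A + card B + (m ∸ l) C suc l ≤ suc m C suc l + 1
cross-intersecting-shifted m l IH 2l+2≤m A B shiftedA shiftedB A×B uniformA uniformB ∣A∣>0 ∣B∣>0 = begin
  (card A₀ + card A₁) + (card B₀ + card B₁) + (m ∸ l) C suc l
    ≡⟨ cong₂ _+_ (interchange (card A₀) (card A₁) (card B₀) (card B₁)) (cong (_C suc l) (∸-suc l<m)) ⟩
  (card A₀ + card B₀) + (card A₁ + card B₁) + suc (m ∸ suc l) C suc l
    ≤⟨ pascal-combine _ _ (m ∸ suc l) m l bound₀ bound₁ ⟩
  suc m C suc l + 1 ∎
  where
  open ≤-Reasoning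
  A₀ A₁ B₀ B₁ : Family m
  A₀ = avoid₀ A
  A₁ = link₀ A
  B₀ = avoid₀ B
  B₁ = link₀ B
  2l+2≤m′ : suc l + suc l ≤ m
  2l+2≤m′ = 2*m≤n⇒m+m≤n {suc l} 2l+2≤m
  l<m : l < m
  l<m = ≤-trans (s≤s (m≤m+n l (suc l))) 2l+2≤m′
  ∣A₀∣>0 : 1 ≤ card A₀
  ∣A₀∣>0 = AllShifted⇒avoid₀-nonempty l A shiftedA uniformA l<m ∣A∣>0
  ∣B₀∣>0 : 1 ≤ card B₀
  ∣B₀∣>0 = AllShifted⇒avoid₀-nonempty l B shiftedB uniformB l<m ∣B∣>0
  bound₀ : card A₀ + card B₀ + (m ∸ suc l) C suc l ≤ m C suc l + 1
  bound₀ = IH (suc l) 2l+2≤m A₀ B₀ (λ X Y → A×B (false ∷ X) (false ∷ Y))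
              (λ X → uniformA (false ∷ X)) (λ X → uniformB (false ∷ X)) ∣A₀∣>0 ∣B₀∣>0
  bound₁ : card A₁ + card B₁ + (m ∸ suc l) C l ≤ m C l
  bound₁ with card-witness A₀ ∣A₀∣>0 | card-witness B₀ ∣B₀∣>0
  ... | GA , A₀GA | GB , B₀GB =
    link-pair-bound m l IH 2l+2≤m A₁ B₁
      (AllShifted⇒link₀-CrossIntersecting l A B shiftedA A×B uniformA uniformB
         (≤-trans (s≤s (+-monoʳ-≤ l (n≤1+n l))) 2l+2≤m′))
      (λ T → suc-injective ∘ uniformA (true ∷ T)) (λ U → suc-injective ∘ uniformB (true ∷ U))
      GA GB (uniformA (false ∷ GA) A₀GA) (uniformB (false ∷ GB) B₀GB)
      (λ T A₁T → A×B (true ∷ T) (false ∷ GB) A₁T B₀GB)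
      (λ U B₁U → trans (meets-sym U GA) (A×B (false ∷ GA) (true ∷ U) A₀GA B₁U))

cross-intersecting-bound : ∀ m → CrossIntersectingBound m
cross-intersecting-bound m zero _ A B A×B uniformA _ ∣A∣>0 ∣B∣>0 =
  ⊥-elim (CrossIntersecting-Uniform0⇒empty A B A×B uniformA ∣A∣>0 ∣B∣>0)
cross-intersecting-bound zero (suc l) ()
cross-intersecting-bound (suc m) (suc l) 2l+2≤1+m A B A×B uniformA uniformB ∣A∣>0 ∣B∣>0
  with suc m ≟ℕ 2 * suc l
... | yes balanced = cross-intersecting-balanced m l balanced A B A×B uniformA uniformB
... | no unbalanced =
  subst₂ (λ a b → a + b + (m ∸ l) C suc l ≤ suc m C suc l + 1) (card-shiftAll ys A) (card-shiftAll ys B)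
    (cross-intersecting-shifted m l (cross-intersecting-bound m) (s≤s⁻¹ (≤∧≢⇒< 2l+2≤1+m (unbalanced ∘ sym)))
       (shiftAll ys A) (shiftAll ys B) (shiftAll-AllShifted A) (shiftAll-AllShifted B)
       (shiftAll-CrossIntersecting ys A B A×B) (shiftAll-Uniform ys (suc l) A uniformA)
       (shiftAll-Uniform ys (suc l) B uniformB)
       (subst (1 ≤_) (sym (card-shiftAll ys A)) ∣A∣>0) (subst (1 ≤_) (sym (card-shiftAll ys B)) ∣B∣>0))
  where ys = allFin m

-- The Hilton–Milner theorem

-- {0, r+1} meets every member of F.
Transversal₀ : ∀ {n} → Fin n → Family (suc n) → Set
Transversal₀ r F = ∀ T → avoid₀ F T ≡ true → lookup T r ≡ true

-- If shifting towards y+1 makes a nontrivial family trivial, the centre can only be y+1.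
shift-Trivial⇒Transversal₀ : ∀ {n} (y : Fin n) (F : Family (suc n)) → ¬ Trivial F → Trivial (shift y F) →
                              Transversal₀ y F
shift-Trivial⇒Transversal₀ y F _ (zero , centred) T F₀T =
  case centred (false ∷ T) (shift-keeps-avoid₀ y F T F₀T) of λ ()
shift-Trivial⇒Transversal₀ y F nontrivial (suc p , centred) T F₀T with p Fin.≟ y
... | yes refl = centred (false ∷ T) (shift-keeps-avoid₀ y F T F₀T)
... | no  p≢y  = ⊥-elim (nontrivial (suc p , F∋p))
  where
  F∋p : ∀ Z → F Z ≡ true → lookup Z (suc p) ≡ true
  F∋p Z FZ with shift y F Z in sFZ
  ... | true  = centred Z sFZ
  ... | false with shift-removed y F Z FZ sFZ
  ... | U , refl , sFU′ = trans (sym (lookup∘update′ p≢y U true)) (centred (false ∷ U [ y ]≔ true) sFU′)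

shift-or-Transversal₀ : ∀ {n} k (ys : List (Fin n)) (F : Family (suc n)) →
                        Intersecting F → Uniform k F → ¬ Trivial F →
                        ∃ λ G → Intersecting G × Uniform k G × ¬ Trivial G × card G ≡ card F ×
                                ((∀ y → y ∈ ys → Shifted y G) ⊎ ∃ λ r → Transversal₀ r G)
shift-or-Transversal₀ k [] F intersecting uniform nontrivial =
  F , intersecting , uniform , nontrivial , refl , inj₁ λ _ ()
shift-or-Transversal₀ k (y ∷ ys) F intersecting uniform nontrivial
  with shift-or-Transversal₀ k ys F intersecting uniform nontrivial
... | G , G-intersecting , G-uniform , G-nontrivial , ∣G∣≡∣F∣ , inj₂ transversal =
  G , G-intersecting , G-uniform , G-nontrivial , ∣G∣≡∣F∣ , inj₂ transversal
... | G , G-intersecting , G-uniform , G-nontrivial , ∣G∣≡∣F∣ , inj₁ G-shifted with trivial? (shift y G)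
...   | yes trivial = G , G-intersecting , G-uniform , G-nontrivial , ∣G∣≡∣F∣ ,
                      inj₂ (y , shift-Trivial⇒Transversal₀ y G G-nontrivial trivial)
...   | no nontrivial′ = shift y G , shift-CrossIntersecting y G G G-intersecting , shift-Uniform y k G G-uniform ,
                         nontrivial′ , trans (card-shift y G) ∣G∣≡∣F∣ , inj₁ shifted
  where
  shifted : ∀ z → z ∈ y ∷ ys → Shifted z (shift y G)
  shifted z (here refl) = shift-Shifted y G
  shifted z (there z∈ys) = shift-preserves-Shifted y z G (G-shifted z z∈ys)

HiltonMilnerBound : ℕ → Set
HiltonMilnerBound n = ∀ k → 2 * suc k ≤ suc n → (F : Family (suc n)) → Intersecting F → Uniform (suc k) F →
                      ¬ Trivial F → card F + (n ∸ suc k) C k ≤ n C k + 1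

-- Split the members by 0 and r+1: those through 0 but not r+1 (A) and those through r+1 but not 0 (B)
-- form a cross-intersecting pair on the remaining points; those through both are (k-1)-sets there.
Transversal₀-bound : ∀ n k → 2 * suc k ≤ suc n → (F : Family (suc n)) → Intersecting F → Uniform (suc k) F →
                     ¬ Trivial F → (r : Fin n) → Transversal₀ r F → card F + (n ∸ suc k) C k ≤ n C k + 1
Transversal₀-bound n zero _ F intersecting uniform nontrivial _ _ =
  ⊥-elim (nontrivial (Intersecting-Uniform1⇒Trivial F intersecting uniform))
Transversal₀-bound zero (suc k) (s≤s ())
Transversal₀-bound (suc n) (suc k) 2k+4≤n+2 F intersecting uniform nontrivial r transversal = begin
  card F + (n ∸ suc k) C suc k
    ≡⟨ cong₂ (λ f₀ f₁ → f₀ + f₁ + (n ∸ suc k) C suc k)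
             (card-through (avoid₀ F) r transversal) (∑-insertAt r (𝟙 ∘ link₀ F)) ⟩
  card B + (card A + card Both) + (n ∸ suc k) C suc k
    ≡⟨ regroup (card B) (card A) (card Both) _ ⟩
  (card A + card B + (n ∸ suc k) C suc k) + card Both
    ≤⟨ +-mono-≤ (cross-intersecting-bound n (suc k) 2k+2≤n A B A×B uniformA uniformB ∣A∣>0 ∣B∣>0) ∣Both∣≤ ⟩
  (n C suc k + 1) + n C k
    ≡⟨ pascal+1 n k ⟩
  suc n C suc k + 1 ∎
  where
  open ≤-Reasoning
  A B Both : Family n
  A U = link₀ F (insertAt U r false)
  B U = avoid₀ F (insertAt U r true)
  Both U = link₀ F (insertAt U r true)
  2k+2≤n : 2 * suc k ≤ n
  2k+2≤n = s≤s⁻¹ (≤-trans (≤-reflexive (sym (+-suc (suc k) (suc k + 0)))) (s≤s⁻¹ 2k+4≤n+2))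
  A×B : CrossIntersecting A B
  A×B U V AU BV = trans (sym (meets-insertAt U V r false true)) (intersecting _ _ AU BV)
  uniformA : Uniform (suc k) A
  uniformA U AU = trans (sym (∣insertAt∣ U r false)) (suc-injective (uniform _ AU))
  uniformB : Uniform (suc k) B
  uniformB U BU = suc-injective (trans (sym (∣insertAt∣ U r true)) (uniform _ BU))
  ∣Both∣≤ : card Both ≤ n C k
  ∣Both∣≤ = subst (card Both ≤_) (card-Layer n k) (card-mono Both⊆Layer)
    where
    Both⊆Layer : ∀ U → Both U ≡ true → Layer k U ≡ true
    Both⊆Layer U BothU =
      ∈-Layer U (suc-injective (trans (sym (∣insertAt∣ U r true)) (suc-injective (uniform _ BothU))))
  ∣B∣>0 : 1 ≤ card B
  ∣B∣>0 with ¬Trivial⇒Escapes nontrivial zero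
  ... | false ∷ T , FX , _ =
    card-pos B (removeAt T r)
      (subst (λ X → avoid₀ F X ≡ true) (sym (insertAt-removeAt′ T r (transversal T FX))) FX)
  ∣A∣>0 : 1 ≤ card A
  ∣A∣>0 with ¬Trivial⇒Escapes nontrivial (suc r)
  ... | false ∷ T , FX , r∉T = case trans (sym r∉T) (transversal T FX) of λ ()
  ... | true  ∷ T , FX , r∉T =
    card-pos A (removeAt T r) (subst (λ X → link₀ F X ≡ true) (sym (insertAt-removeAt′ T r r∉T)) FX)
  regroup : ∀ b a c x → b + (a + c) + x ≡ (a + b + x) + c
  regroup = solve 4 (λ b a c x → b :+ (a :+ c) :+ x := (a :+ b :+ x) :+ c) refl

hilton-milner-balanced : ∀ n k → suc (suc n) ≡ 2 * suc (suc k) → (F : Family (suc (suc n))) → Intersecting F →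
                         Uniform (suc (suc k)) F → card F + (n ∸ suc k) C suc k ≤ suc n C suc k + 1
hilton-milner-balanced n k balanced F intersecting uniform =
  subst (λ x → card F + x ≤ suc n C suc k + 1) (sym (trans (cong (_C suc k) n∸1+k≡1+k) (nCn≡1 (suc k))))
        (+-monoˡ-≤ 1 (subst (_≤ suc n C suc k) (+-comm (card (link₀ F)) (card (avoid₀ F)))
          (CrossIntersecting-complementary-bound (suc k) (suc (suc k)) (link₀ F) (avoid₀ F)
             (λ T U F₁T F₀U → intersecting (true ∷ T) (false ∷ U) F₁T F₀U)
             (λ T → suc-injective ∘ uniform (true ∷ T)) (λ U → uniform (false ∷ U)) (sym 1+n≡))))
  where
  1+n≡ : suc n ≡ suc k + suc (suc k)
  1+n≡ = suc-injective (trans balanced (2*m≡m+m (suc (suc k))))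
  n∸1+k≡1+k : n ∸ suc k ≡ suc k
  n∸1+k≡1+k = trans (cong (_∸ suc k) (trans (suc-injective 1+n≡) (+-suc k (suc k)))) (m+n∸m≡n (suc k) (suc k))

hilton-milner-slack : ∀ n k → HiltonMilnerBound n → 2 * suc (suc k) ≤ suc n → (H : Family (suc n)) →
                      Intersecting H → Uniform (suc k) H → ¬ Trivial H → card H + (n ∸ suc (suc k)) C k ≤ n C k
hilton-milner-slack n zero _ _ H intersecting uniform nontrivial =
  ⊥-elim (nontrivial (Intersecting-Uniform1⇒Trivial H intersecting uniform))
hilton-milner-slack n (suc k) IH 2k+6≤n+1 H intersecting uniform nontrivial =
  drop-point (card H) n (suc (suc k)) k (n C suc k) 3+k+k≤n
    (IH (suc k) (≤-trans (*-monoʳ-≤ 2 (n≤1+n (suc (suc k)))) 2k+6≤n+1) H intersecting uniform nontrivial)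
  where
  3+k+k≤n : suc (suc (suc k)) + k ≤ n
  3+k+k≤n = s≤s⁻¹ (begin
    suc (suc (suc (suc k)) + k)         ≡⟨ +-suc (suc (suc (suc k))) k ⟨
    suc (suc (suc k)) + suc k
      ≤⟨ +-monoʳ-≤ (suc (suc (suc k))) (≤-trans (n≤1+n (suc k)) (n≤1+n (suc (suc k)))) ⟩
    suc (suc (suc k)) + suc (suc (suc k))
      ≤⟨ 2*m≤n⇒m+m≤n {suc (suc (suc k))} 2k+6≤n+1 ⟩
    suc n                               ∎)
    where open ≤-Reasoning

-- Induction on both halves of a shifted family: the members avoiding 0 form a nontrivial
-- intersecting family on one point fewer, and, by shiftedness, so do the links of 0 unless trivial.
hilton-milner-shifted : ∀ n k → HiltonMilnerBound n → 2 * suc (suc k) ≤ suc n →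
                        (G : Family (suc (suc n))) → Intersecting G → Uniform (suc (suc k)) G → ¬ Trivial G →
                        AllShifted G → card G + (n ∸ suc k) C suc k ≤ suc n C suc k + 1
hilton-milner-shifted n k IH 2k+4≤n+1 G intersecting uniform nontrivial shifted with trivial? (avoid₀ G)
... | yes (p , centred) =
  Transversal₀-bound (suc n) (suc k) (m≤n⇒m≤1+n 2k+4≤n+1) G intersecting uniform nontrivial p centred
... | no G₀-nontrivial = begin
  card G₀ + card G₁ + (n ∸ suc k) C suc k      ≡⟨ cong (λ x → card G₀ + card G₁ + x C suc k) (∸-suc 1+k<n) ⟩
  card G₀ + card G₁ + suc a C suc k            ≤⟨ pascal-combine (card G₀) (card G₁) a n k bound₀ bound₁ ⟩
  suc n C suc k + 1                            ∎
  where
  open ≤-Reasoning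
  G₀ G₁ : Family (suc n)
  G₀ = avoid₀ G
  G₁ = link₀ G
  a : ℕ
  a = n ∸ suc (suc k)
  2k+4≤n+1′ : suc (suc k) + suc (suc k) ≤ suc n
  2k+4≤n+1′ = 2*m≤n⇒m+m≤n {suc (suc k)} 2k+4≤n+1
  1+k<n : suc k < n
  1+k<n = s≤s⁻¹ (≤-trans (s≤s (m≤m+n (suc (suc k)) (suc k)))
                         (≤-trans (≤-reflexive (sym (+-suc (suc (suc k)) (suc k)))) 2k+4≤n+1′))
  bound₀ : card G₀ + a C suc k ≤ n C suc k + 1
  bound₀ = IH (suc k) 2k+4≤n+1 G₀ (λ X Y → intersecting (false ∷ X) (false ∷ Y)) (λ X → uniform (false ∷ X))
              G₀-nontrivial
  G₁-intersecting : Intersecting G₁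
  G₁-intersecting = AllShifted⇒link₀-CrossIntersecting (suc k) G G shifted intersecting uniform uniform
                      (≤-trans (s≤s (+-monoʳ-≤ (suc k) (n≤1+n (suc k)))) 2k+4≤n+1′)
  G₁-uniform : Uniform (suc k) G₁
  G₁-uniform T = suc-injective ∘ uniform (true ∷ T)
  bound₁ : card G₁ + a C k ≤ n C k
  bound₁ with trivial? G₁
  ... | no G₁-nontrivial = hilton-milner-slack n k IH 2k+4≤n+1 G₁ G₁-intersecting G₁-uniform G₁-nontrivial
  ... | yes (p , centred) with ¬Trivial⇒Escapes G₀-nontrivial p
  ... | S , G₀S , p∉S =
    subst (λ s → card G₁ + (n ∸ s) C k ≤ n C k) (uniform (false ∷ S) G₀S)
      (centred-meeting-bound k G₁ p S p∉S centred G₁-uniform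
         (λ T G₁T → intersecting (true ∷ T) (false ∷ S) G₁T G₀S))

hilton-milner : ∀ n → HiltonMilnerBound n
hilton-milner n zero _ F intersecting uniform nontrivial =
  ⊥-elim (nontrivial (Intersecting-Uniform1⇒Trivial F intersecting uniform))
hilton-milner zero (suc k) (s≤s ())
hilton-milner (suc n) (suc k) 2k+4≤n+2 F intersecting uniform nontrivial with suc (suc n) ≟ℕ 2 * suc (suc k)
... | yes balanced = hilton-milner-balanced n k balanced F intersecting uniform
... | no unbalanced with shift-or-Transversal₀ (suc (suc k)) (allFin (suc n)) F intersecting uniform nontrivial
... | G , G-intersecting , G-uniform , G-nontrivial , ∣G∣≡∣F∣ , inj₂ (r , transversal) =
  subst (λ c → c + (suc n ∸ suc (suc k)) C suc k ≤ suc n C suc k + 1) ∣G∣≡∣F∣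
        (Transversal₀-bound (suc n) (suc k) 2k+4≤n+2 G G-intersecting G-uniform G-nontrivial r transversal)
... | G , G-intersecting , G-uniform , G-nontrivial , ∣G∣≡∣F∣ , inj₁ shifted =
  subst (λ c → c + (suc n ∸ suc (suc k)) C suc k ≤ suc n C suc k + 1) ∣G∣≡∣F∣
        (hilton-milner-shifted n k (hilton-milner n) (s≤s⁻¹ (≤∧≢⇒< 2k+4≤n+2 (unbalanced ∘ sym)))
           G G-intersecting G-uniform G-nontrivial (λ y → shifted y (∈-allFin y)))

-- Supports of codewords

_≟ₛ_ : ∀ {n} (X Y : Subset n) → Dec (X ≡ Y)
_≟ₛ_ = ≡-dec _≟𝔹_

∑-indicator : ∀ {n} (c : Subset n) → ∑ (λ b → 𝟙 (does (c ≟ₛ b))) ≡ 1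
∑-indicator []                  = refl
∑-indicator {suc n} (true  ∷ c) = cong₂ _+_ (∑-0 n) (∑-indicator c)
∑-indicator {suc n} (false ∷ c) = cong₂ _+_ (∑-indicator c) (∑-0 n)

length-filter-∷ : ∀ {A : Set} {P : A → Set} (P? : Decidable P) x xs →
                  length (filter P? (x ∷ xs)) ≡ 𝟙 (does (P? x)) + length (filter P? xs)
length-filter-∷ P? x xs with does (P? x)
... | true  = refl
... | false = refl

length-filter-by-key : ∀ {A : Set} {P : A → Set} {n} (P? : Decidable P) (key : A → Subset n) xs →
                       length (filter P? xs) ≡ ∑ (λ b → length (filter (λ x → P? x ×-dec (key x ≟ₛ b)) xs))
length-filter-by-key {n = n} P? key [] = sym (∑-0 n)
length-filter-by-key {P = P} {n} P? key (x ∷ xs) = begin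
  length (filter P? (x ∷ xs))
    ≡⟨ length-filter-∷ P? x xs ⟩
  𝟙 (does (P? x)) + length (filter P? xs)
    ≡⟨ cong₂ _+_ (indicator (does (P? x))) (sym (length-filter-by-key P? key xs)) ⟨
  ∑ (λ b → 𝟙 (does (P? x ×-dec (key x ≟ₛ b)))) + ∑ (λ b → length (filter (Q b) xs))
    ≡⟨ ∑-distrib-+ (λ b → 𝟙 (does (Q b x))) (λ b → length (filter (Q b) xs)) ⟨
  ∑ (λ b → 𝟙 (does (Q b x)) + length (filter (Q b) xs))
    ≡⟨ ∑-cong (λ b → length-filter-∷ (Q b) x xs) ⟨
  ∑ (λ b → length (filter (Q b) (x ∷ xs))) ∎
  where
  open ≡-Reasoning
  Q : ∀ b y → Dec (P y × key y ≡ b)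
  Q b y = P? y ×-dec (key y ≟ₛ b)
  indicator : ∀ d → ∑ (λ b → 𝟙 (d ∧ does (key x ≟ₛ b))) ≡ 𝟙 d
  indicator false = ∑-0 n
  indicator true  = ∑-indicator (key x)

Unique-⊆⇒length≤ : ∀ {A : Set} (xs ys : List A) → Unique xs → (∀ {z} → z ∈ xs → z ∈ ys) → length xs ≤ length ys
Unique-⊆⇒length≤ []       ys _                 _    = z≤n
Unique-⊆⇒length≤ (x ∷ xs) ys (x∉xs ∷ unique) xs⊆ys with ∈-∃++ (xs⊆ys (here refl))
... | ys₁ , ys₂ , refl = begin
  suc (length xs)               ≤⟨ s≤s (Unique-⊆⇒length≤ xs (ys₁ ++ ys₂) unique xs⊆ys₁++ys₂) ⟩
  suc (length (ys₁ ++ ys₂))     ≡⟨ cong suc (length-++ ys₁) ⟩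
  suc (length ys₁ + length ys₂) ≡⟨ +-suc (length ys₁) (length ys₂) ⟨
  length ys₁ + length (x ∷ ys₂) ≡⟨ length-++ ys₁ ⟨
  length (ys₁ ++ x ∷ ys₂)       ∎
  where
  open ≤-Reasoning
  xs⊆ys₁++ys₂ : ∀ {z} → z ∈ xs → z ∈ ys₁ ++ ys₂
  xs⊆ys₁++ys₂ z∈xs with ∈-++⁻ ys₁ (xs⊆ys (there z∈xs))
  ... | inj₁ z∈ys₁         = ∈-++⁺ˡ z∈ys₁
  ... | inj₂ (here refl)   = ⊥-elim (All-lookup x∉xs z∈xs refl)
  ... | inj₂ (there z∈ys₂) = ∈-++⁺ʳ ys₁ z∈ys₂

length≤-by-member : ∀ {A : Set} {xs : List A} {m} → (∀ {x} → x ∈ xs → length xs ≤ m) → length xs ≤ m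
length≤-by-member {xs = []}    _       = z≤n
length≤-by-member {xs = _ ∷ _} bounded = bounded (here refl)

module _ (F : FiniteField) where
  open FiniteField F renaming (_+_ to _+F_; _*_ to _*F_)
  open Code F
  private module R = IsCommutativeRing isCommutativeRing

  nonzero? : Carrier → Bool
  nonzero? a = not (does (a ≟ 0#))

  nonzero?⇒≢0 : ∀ {a} → nonzero? a ≡ true → ¬ a ≡ 0#
  nonzero?⇒≢0 {a} nonzero with a ≟ 0#
  ... | no a≢0 = a≢0

  ≢0⇒nonzero? : ∀ {a} → ¬ a ≡ 0# → nonzero? a ≡ true
  ≢0⇒nonzero? {a} a≢0 with a ≟ 0#
  ... | yes a≡0 = ⊥-elim (a≢0 a≡0)
  ... | no  _   = refl

  support : ∀ {n} → Word n → Subset n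
  support = Vec.map nonzero?

  InSupport⇒∈support : ∀ {n} (x : Word n) j → InSupport x j → lookup (support x) j ≡ true
  InSupport⇒∈support x j x[j]≢0 = trans (lookup-map j nonzero? x) (≢0⇒nonzero? x[j]≢0)

  ∈support⇒InSupport : ∀ {n} (x : Word n) j → lookup (support x) j ≡ true → InSupport x j
  ∈support⇒InSupport x j j∈σx = nonzero?⇒≢0 (trans (sym (lookup-map j nonzero? x)) j∈σx)

  weight≡∣support∣ : ∀ {n} (x : Word n) → weight x ≡ ∣ support x ∣
  weight≡∣support∣ []      = refl
  weight≡∣support∣ (a ∷ x) with a ≟ 0#
  ... | yes _ = weight≡∣support∣ x
  ... | no  _ = cong suc (weight≡∣support∣ x)

  weight-0· : ∀ {n} (x : Word n) → weight (0# · x) ≡ 0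
  weight-0· []      = refl
  weight-0· (a ∷ x) rewrite R.zeroˡ a with 0# ≟ 0#
  ... | yes _   = weight-0· x
  ... | no 0≢0 = ⊥-elim (0≢0 refl)

  no-zero-divisors : ∀ a c → a *F c ≡ 0# → ¬ c ≡ 0# → a ≡ 0#
  no-zero-divisors a c ac≡0 c≢0 with inverse c c≢0
  ... | c⁻¹ , cc⁻¹≡1 = begin
    a                  ≡⟨ R.*-identityʳ a ⟨
    a *F 1#            ≡⟨ cong (a *F_) cc⁻¹≡1 ⟨
    a *F (c *F c⁻¹)    ≡⟨ R.*-assoc a c c⁻¹ ⟨
    (a *F c) *F c⁻¹    ≡⟨ cong (_*F c⁻¹) ac≡0 ⟩
    0# *F c⁻¹          ≡⟨ R.zeroˡ c⁻¹ ⟩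
    0#                 ∎
    where open ≡-Reasoning

  dist≡0⇒≡ : ∀ {n} (x y : Word n) → dist x y ≡ 0 → x ≡ y
  dist≡0⇒≡ []      []      _ = refl
  dist≡0⇒≡ (a ∷ x) (b ∷ y) d≡0 with a ≟ b
  ... | yes refl = cong (a ∷_) (dist≡0⇒≡ x y d≡0)

  allWords-complete : ∀ n (x : Word n) → x ∈ allWords n
  allWords-complete zero    []      = here refl
  allWords-complete (suc n) (a ∷ x) = ∈-cartesianProductWith⁺ _∷_ (complete a) (allWords-complete n x)

  allWords-unique : ∀ n → Unique (allWords n)
  allWords-unique zero    = [] ∷ []
  allWords-unique (suc n) = Unique.cartesianProductWith⁺ _∷_ ∷-injective unique (allWords-unique n)

  units : List Carrier
  units = filter (¬? ∘ (_≟ 0#)) elements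

  length-units : length units ≤ order ∸ 1
  length-units = m+n≤o⇒m≤o∸n (length units)
    (subst (_≤ order) (+-comm 1 (length units))
           (filter-notAll (¬? ∘ (_≟ 0#)) elements (Any.map (λ 0≡a a≢0 → a≢0 (sym 0≡a)) (complete 0#))))

  -- Disjoint supports make σ(x) ⊆ σ(x ⊕ y), so minimality of x ⊕ y gives x = a · (x ⊕ y);
  -- reading off a coordinate in the support of y forces a = 0.
  minimal-supports-not-disjoint : ∀ {n} (𝒞 : LinearCode n) → IsMinimal 𝒞 → ∀ x y →
                                  LinearCode._∈C 𝒞 x → LinearCode._∈C 𝒞 y → 1 ≤ weight x → 1 ≤ weight y →
                                  (∀ j → InSupport x j → lookup y j ≡ 0#) → ⊥
  minimal-supports-not-disjoint 𝒞 minimal x y x∈C y∈C x≢0 y≢0 disjoint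
    with minimal (x ⊕ y) (LinearCode.⊕∈ 𝒞 x∈C y∈C) x x∈C σx⊆σ[x⊕y]
       | ∣T∣>0⇒∈ (support y) (subst (1 ≤_) (weight≡∣support∣ y) y≢0)
    where
    σx⊆σ[x⊕y] : ∀ j → InSupport x j → InSupport (x ⊕ y) j
    σx⊆σ[x⊕y] j x[j]≢0 x⊕y[j]≡0 = x[j]≢0 (begin
      lookup x j                     ≡⟨ R.+-identityʳ (lookup x j) ⟨
      lookup x j +F 0#               ≡⟨ cong (lookup x j +F_) (disjoint j x[j]≢0) ⟨
      lookup x j +F lookup y j       ≡⟨ lookup-zipWith _+F_ j x y ⟨
      lookup (x ⊕ y) j               ≡⟨ x⊕y[j]≡0 ⟩
      0#                             ∎)
      where open ≡-Reasoning
  ... | a , x≡a·[x⊕y] | j , j∈σy = 1+n≰n (subst (1 ≤_) weight-x≡0 x≢0)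
    where
    y[j]≢0 : ¬ lookup y j ≡ 0#
    y[j]≢0 = ∈support⇒InSupport y j j∈σy
    x[j]≡0 : lookup x j ≡ 0#
    x[j]≡0 with lookup x j ≟ 0#
    ... | yes x[j]≡0 = x[j]≡0
    ... | no  x[j]≢0 = ⊥-elim (y[j]≢0 (disjoint j x[j]≢0))
    a≡0 : a ≡ 0#
    a≡0 = no-zero-divisors a (lookup y j) (begin
      a *F lookup y j                  ≡⟨ cong (a *F_) (R.+-identityˡ (lookup y j)) ⟨
      a *F (0# +F lookup y j)          ≡⟨ cong (λ t → a *F (t +F lookup y j)) x[j]≡0 ⟨
      a *F (lookup x j +F lookup y j)  ≡⟨ cong (a *F_) (lookup-zipWith _+F_ j x y) ⟨
      a *F lookup (x ⊕ y) j            ≡⟨ lookup-map j (a *F_) (x ⊕ y) ⟨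
      lookup (a · (x ⊕ y)) j           ≡⟨ cong (λ t → lookup t j) x≡a·[x⊕y] ⟨
      lookup x j                       ≡⟨ x[j]≡0 ⟩
      0#                               ∎) y[j]≢0
      where open ≡-Reasoning
    weight-x≡0 : weight x ≡ 0
    weight-x≡0 = trans (cong weight x≡a·[x⊕y]) (trans (cong (λ t → weight (t · (x ⊕ y))) a≡0) (weight-0· (x ⊕ y)))

  minimal-supports-meet : ∀ {n} (𝒞 : LinearCode n) → IsMinimal 𝒞 → ∀ x y →
                          LinearCode._∈C 𝒞 x → LinearCode._∈C 𝒞 y → 1 ≤ weight x → 1 ≤ weight y →
                          meets (support x) (support y) ≡ true
  minimal-supports-meet 𝒞 minimal x y x∈C y∈C x≢0 y≢0 with meets (support x) (support y) in σx∩σy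
  ... | true  = refl
  ... | false = ⊥-elim (minimal-supports-not-disjoint 𝒞 minimal x y x∈C y∈C x≢0 y≢0 disjoint)
    where
    disjoint : ∀ j → InSupport x j → lookup y j ≡ 0#
    disjoint j x[j]≢0 with lookup y j ≟ 0#
    ... | yes y[j]≡0 = y[j]≡0
    ... | no  y[j]≢0 = case trans (sym σx∩σy) (meets-intro (support x) (support y) j
                         (InSupport⇒∈support x j x[j]≢0) (InSupport⇒∈support y j y[j]≢0)) of λ ()

  module _ {n} (𝒞 : LinearCode n) (i : ℕ) where
    open LinearCode 𝒞

    HasWeight? : ∀ x → Dec (x ∈C × weight x ≡ i)
    HasWeight? x = ∈C? x ×-dec (weight x ≟ℕ i)

    codewordsWithSupport : Subset n → List (Word n)
    codewordsWithSupport b = filter (λ x → HasWeight? x ×-dec (support x ≟ₛ b)) (allWords n)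

    Supports : Family n
    Supports b = not (null (codewordsWithSupport b))

    weight-i⇒≢0· : 1 ≤ i → ∀ a (x : Word n) → weight (a · x) ≡ i → ¬ a ≡ 0#
    weight-i⇒≢0· i>0 a x weight≡i refl = 1+n≰n (subst (1 ≤_) (trans (sym weight≡i) (weight-0· x)) i>0)

    same-support⇒multiple : IsMinimal 𝒞 → 1 ≤ i → ∀ {x z} → x ∈C → z ∈C → weight z ≡ i →
                            support z ≡ support x → z ∈ map (_· x) units
    same-support⇒multiple minimal i>0 {x} {z} x∈C z∈C weight≡i σz≡σx with minimal x x∈C z z∈C σz⊆σx
      where
      σz⊆σx : ∀ j → InSupport z j → InSupport x j
      σz⊆σx j z[j]≢0 = ∈support⇒InSupport x j (subst (λ σ → lookup σ j ≡ true) σz≡σx (InSupport⇒∈support z j z[j]≢0))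
    ... | a , refl = ∈-map⁺ (_· x) (∈-filter⁺ (¬? ∘ (_≟ 0#)) (complete a) (weight-i⇒≢0· i>0 a x weight≡i))

    length-codewordsWithSupport : IsMinimal 𝒞 → 1 ≤ i → ∀ b → length (codewordsWithSupport b) ≤ order ∸ 1
    length-codewordsWithSupport minimal i>0 b = length≤-by-member bounded
      where
      bounded : ∀ {x} → x ∈ codewordsWithSupport b → length (codewordsWithSupport b) ≤ order ∸ 1
      bounded x∈ with ∈-filter⁻ (λ x → HasWeight? x ×-dec (support x ≟ₛ b)) {xs = allWords n} x∈
      ... | _ , (x∈C , _) , σx≡b = begin
        length (codewordsWithSupport b) ≤⟨ Unique-⊆⇒length≤ _ _ (Unique.filter⁺ _ (allWords-unique n)) multiple ⟩
        length (map (_· _) units)       ≡⟨ length-map _ units ⟩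
        length units                    ≤⟨ length-units ⟩
        order ∸ 1                       ∎
        where
        open ≤-Reasoning
        multiple : ∀ {z} → z ∈ codewordsWithSupport b → z ∈ map (_· _) units
        multiple z∈ with ∈-filter⁻ (λ x → HasWeight? x ×-dec (support x ≟ₛ b)) {xs = allWords n} z∈
        ... | _ , (z∈C , weight≡i) , σz≡b = same-support⇒multiple minimal i>0 x∈C z∈C weight≡i (trans σz≡b (sym σx≡b))

    W≤[q-1]*card-Supports : IsMinimal 𝒞 → 1 ≤ i → W 𝒞 i ≤ (order ∸ 1) * card Supports
    W≤[q-1]*card-Supports minimal i>0 = begin
      W 𝒞 i                                            ≡⟨ length-filter-by-key HasWeight? support (allWords n) ⟩
      ∑ (length ∘ codewordsWithSupport)
        ≤⟨ ∑-mono (λ b → ≤-𝟙-nonempty (length-codewordsWithSupport minimal i>0 b)) ⟩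
      ∑ (λ b → (order ∸ 1) * 𝟙 (Supports b))           ≡⟨ ∑-*ˡ (order ∸ 1) (𝟙 ∘ Supports) ⟩
      (order ∸ 1) * card Supports                      ∎
      where
      open ≤-Reasoning
      ≤-𝟙-nonempty : ∀ {xs : List (Word n)} {m} → length xs ≤ m → length xs ≤ m * 𝟙 (not (null xs))
      ≤-𝟙-nonempty {[]}    _      = z≤n
      ≤-𝟙-nonempty {_ ∷ _} {m} ≤m = subst (_ ≤_) (sym (*-identityʳ m)) ≤m

    Supports-witness : ∀ b → Supports b ≡ true → ∃ λ x → x ∈C × weight x ≡ i × support x ≡ b
    Supports-witness b σ with codewordsWithSupport b in eq
    ... | x ∷ _ with ∈-filter⁻ (λ x → HasWeight? x ×-dec (support x ≟ₛ b)) {xs = allWords n}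
                      (subst (x ∈_) (sym eq) (here refl))
    ... | _ , (x∈C , weight≡i) , σx≡b = x , x∈C , weight≡i , σx≡b

    Supports-intro : ∀ x → x ∈C → weight x ≡ i → Supports (support x) ≡ true
    Supports-intro x x∈C weight≡i with codewordsWithSupport (support x) in eq
    ... | _ ∷ _ = refl
    ... | []    = case subst (x ∈_) eq (∈-filter⁺ (λ z → HasWeight? z ×-dec (support z ≟ₛ support x))
                                         (allWords-complete n x) ((x∈C , weight≡i) , refl)) of λ ()

    Supports-Uniform : Uniform i Supports
    Supports-Uniform b σ with Supports-witness b σ
    ... | x , _ , weight≡i , refl = trans (sym (weight≡∣support∣ x)) weight≡i

    Supports-Intersecting : IsMinimal 𝒞 → 1 ≤ i → Intersecting Supports
    Supports-Intersecting minimal i>0 b b′ σ σ′ with Supports-witness b σ | Supports-witness b′ σ′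
    ... | x , x∈C , wx≡i , refl | y , y∈C , wy≡i , refl =
      minimal-supports-meet 𝒞 minimal x y x∈C y∈C (subst (1 ≤_) (sym wx≡i) i>0) (subst (1 ≤_) (sym wy≡i) i>0)

    Supports-nontrivial : ¬ (∃ λ j → ∀ x → x ∈C → weight x ≡ i → InSupport x j) → ¬ Trivial Supports
    Supports-nontrivial no-common (j , centred) =
      no-common (j , λ x x∈C weight≡i → ∈support⇒InSupport x j (centred (support x) (Supports-intro x x∈C weight≡i)))

m+n≤o+1⇒m≤o∸n+1 : ∀ m n o → m + n ≤ o + 1 → m ≤ (o ∸ n) + 1
m+n≤o+1⇒m≤o∸n+1 m n o m+n≤o+1 = ≤-trans (m+n≤o⇒m≤o∸n m m+n≤o+1)
  (m≤n+o⇒m∸n≤o (o + 1) n (≤-trans (+-monoˡ-≤ 1 (m≤n+m∸n o n)) (≤-reflexive (+-assoc n (o ∸ n) 1))))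

corollary3p14 : (F : FiniteField) → let open Code F in
    (n : ℕ) (𝒞 : LinearCode n) (d i : ℕ) →
    IsMinimal 𝒞 →
    MinDistance 𝒞 d →
    d ≤ i → 2 * i ≤ n →
    ¬ (∃ λ (j : Fin n) → ∀ x → LinearCode._∈C 𝒞 x → weight x ≡ i → InSupport x j) →
    W 𝒞 i ≤ (FiniteField.order F ∸ 1) * ((((n ∸ 1) C (i ∸ 1)) ∸ ((n ∸ i ∸ 1) C (i ∸ 1))) + 1)
corollary3p14 F n 𝒞 d zero minimal ((x , y , _ , _ , x≢y , dist≡0) , _) z≤n _ _ =
  -- The minimum distance only serves to exclude i = 0: then d = 0 is the distance of two distinct codewords.
  ⊥-elim (x≢y (dist≡0⇒≡ F x y dist≡0))
corollary3p14 F zero 𝒞 d (suc k) _ _ _ () _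
corollary3p14 F (suc n) 𝒞 d (suc k) minimal _ _ 2i≤n no-common = begin
  W 𝒞 (suc k)                                   ≤⟨ W≤[q-1]*card-Supports F 𝒞 (suc k) minimal (s≤s z≤n) ⟩
  (q ∸ 1) * card σ𝒞                             ≤⟨ *-monoʳ-≤ (q ∸ 1) (m+n≤o+1⇒m≤o∸n+1 _ _ _ hilton-milner-bound) ⟩
  (q ∸ 1) * ((n C k ∸ (n ∸ suc k) C k) + 1)     ≡⟨ cong (λ m → (q ∸ 1) * ((n C k ∸ m C k) + 1)) n∸k∸1≡n∸[1+k] ⟨
  (q ∸ 1) * ((n C k ∸ (n ∸ k ∸ 1) C k) + 1)     ∎
  where
  open ≤-Reasoning
  open Code F using (W)
  q : ℕ
  q = FiniteField.order F
  σ𝒞 : Family (suc n)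
  σ𝒞 = Supports F 𝒞 (suc k)
  hilton-milner-bound : card σ𝒞 + (n ∸ suc k) C k ≤ n C k + 1
  hilton-milner-bound = hilton-milner n k 2i≤n σ𝒞 (Supports-Intersecting F 𝒞 (suc k) minimal (s≤s z≤n))
                          (Supports-Uniform F 𝒞 (suc k)) (Supports-nontrivial F 𝒞 (suc k) no-common)
  n∸k∸1≡n∸[1+k] : n ∸ k ∸ 1 ≡ n ∸ suc k
  n∸k∸1≡n∸[1+k] = trans (∸-+-assoc n k 1) (cong (n ∸_) (+-comm k 1))
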